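{- Let $n\geq1$ and $s\geq0$ be integers with $\ell_q(n)>s$. Then $$Z_{\mathcal A}(n;s)=\left(\operatorname{BG}(q^{\deg_\theta P}-1-n;s)\bmod P\right)_P$$ in $\mathcal A_s$. In particular, if moreover $s\equiv n\pmod{q-1}$, then $Z_{\mathcal A}(n;s)=0$.
   Context: $A=\mathbb F_q[\theta]$, $\boldsymbol F_s=\mathbb F_q(t_1,\ldots,t_s)$; primes $P$ are monic irreducibles of $A$. $\mathcal A_s=\prod_P\boldsymbol F_s[\theta]/P\boldsymbol F_s[\theta]\,\big/\bigoplus_P\boldsymbol F_s[\theta]/P\boldsymbol F_s[\theta]$ (sequences are identified when they agree for all but finitely many $P$, so components for the finitely many $P$ with $q^{\deg P}\leq n$ are irrelevant). For $a\in A$, $a(t)$ is $a$ with $\theta$ replaced by $t$; $A^+(j)$ monic polynomials of degree $j$. $F_d(n;s)=\sum_{i=0}^{d-1}\sum_{a\in A^+(i)}\frac{a(t_1)\cdots a(t_s)}{a^n}$, $Z_{\mathcal A}(n;s)=(F_{\deg_\theta P}(n;s)\bmod P)_P$. For $N\geq0$, $\operatorname{BG}(N;s)=\sum_{j\geq0}\sum_{a\in A^+(j)}a^Na(t_1)\cdots a(t_s)\in A[t_1,\ldots,t_s]$ (only finitely many inner sums are non-zero). $\ell_q(n)$ is the sum of the base-$q$ digits of $n$. -}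

module Defs where

open import Level using (0ℓ)
open import Algebra.Bundles using (CommutativeRing)
open import Data.Nat as ℕ using (ℕ; zero; suc; _≤_; _<_; _∸_; _^_)
open import Data.Nat.DivMod using (_%_; _/_)
open import Data.Fin using (Fin)
open import Data.List using (List; []; _∷_; [_]; map; foldr; length; concatMap; _++_)
open import Data.List.Membership.Propositional using (_∈_)
open import Data.List.Relation.Unary.Unique.Propositional using (Unique)
open import Data.List.Relation.Unary.All using (All)
open import Data.List.Relation.Unary.Any using (Any)
open import Data.Vec using (Vec; toList) renaming ([] to []v; _∷_ to _∷v_)
open import Data.Product using (Σ; ∃; _×_; _,_)
open import Data.Sum using (_⊎_)
open import Relation.Nullary using (¬_)
open import Relation.Binary.PropositionalEquality using (_≡_)

-- Base-b digit sum ℓ_b(n).  Only meaningful for b ≥ 2 (q ≥ 2 always);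
-- for b ∈ {0,1} it is set to 0 (never used).
digitSumAux : ℕ → ℕ → ℕ → ℕ
digitSumAux b zero m = 0
digitSumAux b (suc fuel) zero = 0
digitSumAux b (suc fuel) (suc m) =
  ((suc m) % (suc (suc b))) ℕ.+ digitSumAux b fuel ((suc m) / (suc (suc b)))

ℓ : ℕ → ℕ → ℕ
ℓ zero n = 0
ℓ (suc zero) n = 0
ℓ (suc (suc b)) n = digitSumAux b n n

CongNat : ℕ → ℕ → ℕ → Set
CongNat m a b = ∃ λ k → (a ≡ b ℕ.+ k ℕ.* m) ⊎ (b ≡ a ℕ.+ k ℕ.* m)

record FiniteField : Set₁ where
  field
    ring : CommutativeRing 0ℓ 0ℓ
  open CommutativeRing ring using (Carrier; _≈_; _*_; 0#; 1#)
  field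
    ≈⇒≡ : ∀ {x y} → x ≈ y → x ≡ y
    0≢1 : ¬ (0# ≡ 1#)
    inverse : ∀ x → ¬ (x ≡ 0#) → ∃ λ y → x * y ≡ 1#
    elems : List Carrier
    elems-complete : ∀ x → x ∈ elems
    elems-unique : Unique elems

module Over (F : FiniteField) where
  open FiniteField F
  open CommutativeRing ring using (Carrier; _+_; _*_; -_; 0#; 1#)

  q : ℕ
  q = length elems

  -- A = F_q[θ]: coefficient lists, little-endian (coefficient of θ^i at i).
  Poly : Set
  Poly = List Carrier

  coeff : Poly → ℕ → Carrier
  coeff [] _ = 0#
  coeff (x ∷ xs) zero = x
  coeff (x ∷ xs) (suc i) = coeff xs i

  -- equality of polynomials (coefficientwise; trailing zeros irrelevant)
  _≈ₚ_ : Poly → Poly → Set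
  f ≈ₚ g = ∀ i → coeff f i ≡ coeff g i

  zeroₚ oneₚ : Poly
  zeroₚ = []
  oneₚ = [ 1# ]

  _+ₚ_ : Poly → Poly → Poly
  [] +ₚ g = g
  (x ∷ xs) +ₚ [] = x ∷ xs
  (x ∷ xs) +ₚ (y ∷ ys) = (x + y) ∷ (xs +ₚ ys)

  negₚ : Poly → Poly
  negₚ = map -_

  scale : Carrier → Poly → Poly
  scale c = map (c *_)

  _*ₚ_ : Poly → Poly → Poly
  [] *ₚ g = []
  (x ∷ xs) *ₚ g = scale x g +ₚ (0# ∷ (xs *ₚ g))

  _^ₚ_ : Poly → ℕ → Poly
  f ^ₚ zero = oneₚ
  f ^ₚ suc k = f *ₚ (f ^ₚ k)

  sumₚ : List Poly → Poly
  sumₚ = foldr _+ₚ_ zeroₚ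

  sumBelow : ℕ → (ℕ → Poly) → Poly
  sumBelow zero f = zeroₚ
  sumBelow (suc J) f = sumBelow J f +ₚ f J

  _∣ₚ_ : Poly → Poly → Set
  P ∣ₚ g = ∃ λ h → g ≈ₚ (h *ₚ P)

  CongMod : Poly → Poly → Poly → Set
  CongMod P f g = P ∣ₚ (f +ₚ negₚ g)

  IsUnit : Poly → Set
  IsUnit f = ∃ λ g → (f *ₚ g) ≈ₚ oneₚ

  Irreducible : Poly → Set
  Irreducible f = (¬ (f ≈ₚ zeroₚ)) × (¬ IsUnit f)
                  × (∀ g h → f ≈ₚ (g *ₚ h) → IsUnit g ⊎ IsUnit h)

  monic : {d : ℕ} → Vec Carrier d → Poly
  monic cs = toList cs ++ [ 1# ]

  allVecs : (j : ℕ) → List (Vec Carrier j)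
  allVecs zero = [ []v ]
  allVecs (suc j) = concatMap (λ x → map (x ∷v_) (allVecs j)) elems

  monics : ℕ → List Poly
  monics j = map monic (allVecs j)

  -- coefficient of the monomial t_1^{m 1} ⋯ t_s^{m s} in a(t_1)⋯a(t_s)
  prodFin : (s : ℕ) → (Fin s → Carrier) → Carrier
  prodFin zero f = 1#
  prodFin (suc s) f = f Fin.zero * prodFin s (λ k → f (Fin.suc k))

  tCoeff : (s : ℕ) → (Fin s → ℕ) → Poly → Carrier
  tCoeff s m a = prodFin s (λ k → coeff a (m k))

  -- coefficient (in A) of t^m in the inner BG sum Σ_{a∈A^+(j)} a^N a(t_1)⋯a(t_s)
  BGterm : (N s j : ℕ) → (Fin s → ℕ) → Poly
  BGterm N s j m = sumₚ (map (λ a → scale (tCoeff s m a) (a ^ₚ N)) (monics j))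

  -- coefficient of t^m in F_d(n;s) mod P, where inv a is a chosen
  -- inverse of a^n modulo P:  Σ_{i<d} Σ_{a∈A^+(i)} (coeff of t^m in a(t)…) · a^{-n}
  Zcoeff : (d s : ℕ) → (Poly → Poly) → (Fin s → ℕ) → Poly
  Zcoeff d s inv m =
    sumBelow d (λ i → sumₚ (map (λ a → scale (tCoeff s m a) (inv a)) (monics i)))

  InvFamily : (n d : ℕ) → Poly → (Poly → Poly) → Set
  InvFamily n d P inv =
    ∀ i → i < d → All (λ a → CongMod P (inv a *ₚ (a ^ₚ n)) oneₚ) (monics i)

  NotIn : Poly → List Poly → Set
  NotIn P L = ¬ Any (λ Q → Q ≈ₚ P) L

-- Modulo a prime P of degree d > n, Fermat's little theorem in A/P gives a^(-n) ≡ a^N with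
-- N = q^d - 1 - n for every monic a of degree < d, so F_d(n;s) ≡ Σ_{j<d} Σ_{a∈A+(j)} a^N a(t_1)⋯a(t_s).
-- The inner sums vanish for j ≥ d: coefficientwise, a^N a(t_1)⋯a(t_s) is a product of
-- s + ℓ_q(N) affine forms in the coefficients of a (expand a^N along the base-q digits of N
-- using Frobenius), and a sum over F^j of a product of fewer than j(q - 1) affine forms is 0.
-- Here ℓ_q(N) = d(q - 1) - ℓ_q(n) < d(q - 1) - s, since subtracting n from q^d - 1 never borrows.
-- If moreover s ≡ n (mod q - 1), then c^(s+N) = 1 for c ≠ 0 and the partial sums of the BG
-- terms telescope to 0.
module Submission where

module ListSums where

  open import Level using (0ℓ)
  open import Algebra.Bundles using (CommutativeMonoid)
  open import Data.List using (List; []; _∷_; _++_; map; concatMap)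
  open import Data.List.Relation.Unary.Any using (here; there)
  open import Data.List.Relation.Unary.All using (All; []; _∷_)
  open import Data.List.Relation.Unary.All.Properties using (All¬⇒¬Any)
  open import Data.List.Relation.Unary.AllPairs using ([]; _∷_)
  open import Data.List.Membership.Propositional using (_∈_; _∉_)
  open import Data.List.Membership.Propositional.Properties using (∈-∃++)
  open import Data.List.Relation.Unary.Unique.Propositional using (Unique)
  import Data.List.Relation.Unary.Unique.Propositional.Properties as UP
  open import Data.Product using (_×_; _,_)
  open import Data.Sum using (_⊎_; inj₁; inj₂)
  open import Data.Empty using (⊥-elim)
  open import Relation.Binary.PropositionalEquality as P using (_≡_; refl)

  ∈-mid⁻ : ∀ {X : Set} {y x : X} (V1 V2 : List X) → y ∈ V1 ++ x ∷ V2 → y ≡ x ⊎ y ∈ V1 ++ V2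
  ∈-mid⁻ [] V2 (here p) = inj₁ p
  ∈-mid⁻ [] V2 (there m) = inj₂ m
  ∈-mid⁻ (v ∷ V1) V2 (here p) = inj₂ (here p)
  ∈-mid⁻ (v ∷ V1) V2 (there m) with ∈-mid⁻ V1 V2 m
  ... | inj₁ p = inj₁ p
  ... | inj₂ m' = inj₂ (there m')

  ∈-mid⁺ : ∀ {X : Set} {y x : X} (V1 V2 : List X) → y ∈ V1 ++ V2 → y ∈ V1 ++ x ∷ V2
  ∈-mid⁺ [] V2 m = there m
  ∈-mid⁺ (v ∷ V1) V2 (here p) = here p
  ∈-mid⁺ (v ∷ V1) V2 (there m) = there (∈-mid⁺ V1 V2 m)

  All-mid : ∀ {X : Set} {P : X → Set} {x : X} (V1 V2 : List X) → All P (V1 ++ x ∷ V2) → P x × All P (V1 ++ V2)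
  All-mid [] V2 (px ∷ a) = px , a
  All-mid (v ∷ V1) V2 (pv ∷ a) with All-mid V1 V2 a
  ... | px , a' = px , (pv ∷ a')

  Unique-mid : ∀ {X : Set} {x : X} (V1 V2 : List X) → Unique (V1 ++ x ∷ V2) → Unique (V1 ++ V2) × x ∉ V1 ++ V2
  Unique-mid [] V2 (a ∷ u) = u , All¬⇒¬Any a
  Unique-mid {x = x} (v ∷ V1) V2 (a ∷ u) with Unique-mid V1 V2 u | All-mid V1 V2 a
  ... | u' , nin | vx , a' = (a' ∷ u') , λ { (here p) → vx (P.sym p) ; (there m) → nin m }

  Unique-head : ∀ {X : Set} {x : X} {U} → Unique (x ∷ U) → x ∉ U
  Unique-head (a ∷ u) = All¬⇒¬Any a

  Unique-tail : ∀ {X : Set} {x : X} {U} → Unique (x ∷ U) → Unique U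
  Unique-tail (a ∷ u) = u

  module CommMonoidSums (M : CommutativeMonoid 0ℓ 0ℓ) where
    open CommutativeMonoid M renaming (_∙_ to _+_; ε to 0#; ∙-cong to +-cong; assoc to +-assoc; identityˡ to +-idˡ; refl to ≈refl; sym to ≈sym; trans to ≈trans; reflexive to ≈reflexive)
    open import Algebra.Properties.CommutativeSemigroup commutativeSemigroup using (interchange; x∙yz≈y∙xz)

    Σl : {X : Set} → List X → (X → Carrier) → Carrier
    Σl [] f = 0#
    Σl (x ∷ xs) f = f x + Σl xs f

    Σl-cong : {X : Set} (xs : List X) {f g : X → Carrier} → (∀ x → f x ≈ g x) → Σl xs f ≈ Σl xs g
    Σl-cong [] e = ≈refl
    Σl-cong (x ∷ xs) e = +-cong (e x) (Σl-cong xs e)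

    Σl-cong∈ : {X : Set} (xs : List X) {f g : X → Carrier} → (∀ x → x ∈ xs → f x ≈ g x) → Σl xs f ≈ Σl xs g
    Σl-cong∈ [] e = ≈refl
    Σl-cong∈ (x ∷ xs) e = +-cong (e x (here refl)) (Σl-cong∈ xs (λ y m → e y (there m)))

    Σl-++ : {X : Set} (xs ys : List X) (f : X → Carrier) → Σl (xs ++ ys) f ≈ Σl xs f + Σl ys f
    Σl-++ [] ys f = ≈sym (+-idˡ _)
    Σl-++ (x ∷ xs) ys f = ≈trans (+-cong ≈refl (Σl-++ xs ys f)) (≈sym (+-assoc _ _ _))

    Σl-map : {X Y : Set} (h : X → Y) (xs : List X) (f : Y → Carrier) → Σl (map h xs) f ≡ Σl xs (λ x → f (h x))
    Σl-map h [] f = refl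
    Σl-map h (x ∷ xs) f = P.cong (f (h x) +_) (Σl-map h xs f)

    Σl-concatMap : {X Y : Set} (h : X → List Y) (xs : List X) (f : Y → Carrier) → Σl (concatMap h xs) f ≈ Σl xs (λ x → Σl (h x) f)
    Σl-concatMap h [] f = ≈refl
    Σl-concatMap h (x ∷ xs) f = ≈trans (Σl-++ (h x) (concatMap h xs) f) (+-cong ≈refl (Σl-concatMap h xs f))

    Σl-+ : {X : Set} (xs : List X) (f g : X → Carrier) → Σl xs (λ x → f x + g x) ≈ Σl xs f + Σl xs g
    Σl-+ [] f g = ≈sym (+-idˡ _)
    Σl-+ (x ∷ xs) f g = ≈trans (+-cong ≈refl (Σl-+ xs f g)) (interchange _ _ _ _)

    Σl-0 : {X : Set} (xs : List X) → Σl xs (λ _ → 0#) ≈ 0#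
    Σl-0 [] = ≈refl
    Σl-0 (x ∷ xs) = ≈trans (+-idˡ _) (Σl-0 xs)

    Σl-swap : {X Y : Set} (xs : List X) (ys : List Y) (f : X → Y → Carrier) →
              Σl xs (λ x → Σl ys (f x)) ≈ Σl ys (λ y → Σl xs (λ x → f x y))
    Σl-swap [] ys f = ≈sym (Σl-0 ys)
    Σl-swap (x ∷ xs) ys f = ≈trans (+-cong ≈refl (Σl-swap xs ys f)) (≈sym (Σl-+ ys (f x) (λ y → Σl xs (λ x' → f x' y))))

    Σl-mid : {X : Set} (V1 V2 : List X) (x : X) (f : X → Carrier) → Σl (V1 ++ x ∷ V2) f ≈ f x + Σl (V1 ++ V2) f
    Σl-mid [] V2 x f = ≈refl
    Σl-mid (v ∷ V1) V2 x f = ≈trans (+-cong ≈refl (Σl-mid V1 V2 x f)) (x∙yz≈y∙xz _ _ _)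

    Σl-sameElements : {X : Set} (U V : List X) → Unique U → Unique V → (∀ {x} → x ∈ U → x ∈ V) → (∀ {x} → x ∈ V → x ∈ U) →
              (f : X → Carrier) → Σl U f ≈ Σl V f
    Σl-sameElements [] [] uU uV i j f = ≈refl
    Σl-sameElements [] (y ∷ V) uU uV i j f with j (here refl)
    ... | ()
    Σl-sameElements (x ∷ U) V uU uV i j f with ∈-∃++ (i (here refl))
    ... | V1 , V2 , refl with Unique-mid V1 V2 uV
    ... | uV' , xnin = ≈trans (+-cong ≈refl (Σl-sameElements U (V1 ++ V2) (Unique-tail uU) uV' i' j' f)) (≈sym (Σl-mid V1 V2 x f))
      where
      i' : ∀ {y} → y ∈ U → y ∈ V1 ++ V2
      i' {y} m with ∈-mid⁻ V1 V2 (i (there m))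
      ... | inj₁ refl = ⊥-elim (Unique-head uU m)
      ... | inj₂ m' = m'
      j' : ∀ {y} → y ∈ V1 ++ V2 → y ∈ U
      j' {y} m with j (∈-mid⁺ V1 V2 m)
      ... | here refl = ⊥-elim (xnin m)
      ... | there m' = m'

    Σl-reindex : {X : Set} (U : List X) → Unique U → (∀ x → x ∈ U) → (σ τ : X → X) → (∀ x → τ (σ x) ≡ x) → (∀ x → σ (τ x) ≡ x) →
             (f : X → Carrier) → Σl U (λ x → f (σ x)) ≈ Σl U f
    Σl-reindex U uU cU σ τ στ τσ f = ≈trans (≈reflexive (P.sym (Σl-map σ U f)))
      (Σl-sameElements (map σ U) U (UP.map⁺ inj uU) uU (λ {x} _ → cU x) (λ {x} _ → P.subst (_∈ map σ U) (τσ x) (memmap (cU (τ x)))) f)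
      where
      inj : ∀ {x y} → σ x ≡ σ y → x ≡ y
      inj {x} {y} e = P.trans (P.sym (στ x)) (P.trans (P.cong τ e) (στ y))
      memmap : ∀ {y W} → y ∈ W → σ y ∈ map σ W
      memmap (here p) = here (P.cong σ p)
      memmap (there m) = there (memmap m)


module CommutativeRings where

  open import Level using (0ℓ)
  open import Algebra.Bundles using (CommutativeRing)
  open import Data.List using (List; []; _∷_; length)
  open import Data.List.Relation.Unary.Any using (here; there)
  open import Data.List.Relation.Unary.All using ([]; _∷_)
  open import Data.List.Relation.Unary.AllPairs using ([]; _∷_)
  open import Data.List.Membership.Propositional using (_∈_; _∉_)
  open import Data.List.Relation.Unary.Unique.Propositional using (Unique)
  open import Data.Product using (∃; _,_)
  open import Data.Empty using (⊥-elim)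
  open import Relation.Nullary using (¬_; Dec; yes; no)
  open import Relation.Binary.PropositionalEquality as P using (_≡_)
  open ListSums

  module RingLemmas (K : CommutativeRing 0ℓ 0ℓ) where
    open CommutativeRing K public
    open import Algebra.Properties.Semiring.Exp semiring public
    open import Algebra.Solver.Ring.NaturalCoefficients.Default commutativeSemiring using (solve; _:=_; _:+_; _:*_)
    module SM = CommMonoidSums +-commutativeMonoid
    module PM = CommMonoidSums *-commutativeMonoid
    open SM public using (Σl; Σl-cong; Σl-cong∈; Σl-map; Σl-concatMap; Σl-+; Σl-0; Σl-swap; Σl-reindex)
    Πl : {X : Set} → List X → (X → Carrier) → Carrier
    Πl = PM.Σl
    open import Relation.Binary.Reasoning.Setoid setoid public
    import Algebra.Properties.Ring
    module RP = Algebra.Properties.Ring ring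

    Σl-*ˡ : {X : Set} (xs : List X) (c : Carrier) (f : X → Carrier) → c * Σl xs f ≈ Σl xs (λ x → c * f x)
    Σl-*ˡ [] c f = zeroʳ c
    Σl-*ˡ (x ∷ xs) c f = trans (distribˡ c _ _) (+-cong refl (Σl-*ˡ xs c f))

    Σl-*ʳ : {X : Set} (xs : List X) (c : Carrier) (f : X → Carrier) → Σl xs f * c ≈ Σl xs (λ x → f x * c)
    Σl-*ʳ xs c f = trans (*-comm _ c) (trans (Σl-*ˡ xs c f) (Σl-cong xs (λ x → *-comm c (f x))))

    Πl-const : {X : Set} (xs : List X) (a : Carrier) → Πl xs (λ _ → a) ≈ a ^ length xs
    Πl-const [] a = refl
    Πl-const (x ∷ xs) a = *-cong refl (Πl-const xs a)

    Πl-* : {X : Set} (xs : List X) (f g : X → Carrier) → Πl xs (λ x → f x * g x) ≈ Πl xs f * Πl xs g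
    Πl-* = PM.Σl-+

    Inv : Carrier → Set
    Inv x = ∃ λ y → x * y ≈ 1#

    Inv-* : ∀ {x y} → Inv x → Inv y → Inv (x * y)
    Inv-* {x} {y} (x' , e) (y' , e') = (x' * y') , (begin
      (x * y) * (x' * y') ≈⟨ solve 4 (λ x y x' y' → (x :* y) :* (x' :* y') := (x :* x') :* (y :* y')) refl x y x' y' ⟩
      (x * x') * (y * y') ≈⟨ *-cong e e' ⟩
      1# * 1# ≈⟨ *-identityˡ 1# ⟩
      1# ∎)

    Inv-cong : ∀ {x y} → x ≈ y → Inv x → Inv y
    Inv-cong e (x' , e') = x' , trans (*-cong (sym e) refl) e'

    Inv-Πl : {X : Set} (xs : List X) (f : X → Carrier) → (∀ x → x ∈ xs → Inv (f x)) → Inv (Πl xs f)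
    Inv-Πl [] f h = 1# , *-identityˡ 1#
    Inv-Πl (x ∷ xs) f h = Inv-* (h x (here P.refl)) (Inv-Πl xs f (λ y m → h y (there m)))

    cancelˡ : ∀ {x y z} → Inv x → x * y ≈ x * z → y ≈ z
    cancelˡ {x} {y} {z} (x' , e) e' = begin
      y ≈⟨ sym (*-identityˡ y) ⟩
      1# * y ≈⟨ *-cong (sym (trans (*-comm x' x) e)) refl ⟩
      (x' * x) * y ≈⟨ *-assoc x' x y ⟩
      x' * (x * y) ≈⟨ *-cong refl e' ⟩
      x' * (x * z) ≈⟨ sym (*-assoc x' x z) ⟩
      (x' * x) * z ≈⟨ *-cong (trans (*-comm x' x) e) refl ⟩
      1# * z ≈⟨ *-identityˡ z ⟩
      z ∎

    Πl-multiplier≈1 : {X : Set} (U : List X) → Unique U → (∀ x → x ∈ U) → (σ τ : X → X) →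
                      (∀ x → τ (σ x) ≡ x) → (∀ x → σ (τ x) ≡ x) → (G H : X → Carrier) →
                      (∀ x → G (σ x) ≈ H x * G x) → Inv (Πl U G) → Πl U H ≈ 1#
    Πl-multiplier≈1 U uU cU σ τ στ τσ G H G∘σ≈H*G invG = cancelˡ invG (begin
      Πl U G * Πl U H         ≈⟨ *-comm _ _ ⟩
      Πl U H * Πl U G         ≈⟨ sym (Πl-* U H G) ⟩
      Πl U (λ x → H x * G x)  ≈⟨ sym (PM.Σl-cong U G∘σ≈H*G) ⟩
      Πl U (λ x → G (σ x))    ≈⟨ PM.Σl-reindex U uU cU σ τ στ τσ G ⟩
      Πl U G                  ≈⟨ sym (*-identityʳ _) ⟩
      Πl U G * 1# ∎)

    choose : {Q : Set} → Dec Q → Carrier → Carrier → Carrier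
    choose (yes _) a b = a
    choose (no _) a b = b

    module _ {X : Set} (_≟_ : (x y : X) → Dec (x ≡ y)) where

      Πl-choose-∉ : (z : X) (a b : Carrier) (xs : List X) → z ∉ xs → Πl xs (λ x → choose (x ≟ z) a b) ≈ Πl xs (λ _ → b)
      Πl-choose-∉ z a b xs nin = PM.Σl-cong∈ xs go
        where
        go : ∀ x → x ∈ xs → choose (x ≟ z) a b ≈ b
        go x m with x ≟ z
        ... | yes P.refl = ⊥-elim (nin m)
        ... | no _ = refl

      Σl-choose-∉ : (z : X) (a b : Carrier) (xs : List X) → z ∉ xs → Σl xs (λ x → choose (x ≟ z) a b) ≈ Σl xs (λ _ → b)
      Σl-choose-∉ z a b xs nin = Σl-cong∈ xs go
        where
        go : ∀ x → x ∈ xs → choose (x ≟ z) a b ≈ b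
        go x m with x ≟ z
        ... | yes P.refl = ⊥-elim (nin m)
        ... | no _ = refl

      Πl-choose-once : (z : X) (a : Carrier) (xs : List X) → Unique xs → z ∈ xs → Πl xs (λ x → choose (x ≟ z) a 1#) ≈ a
      Πl-choose-once z a [] u ()
      Πl-choose-once z a (y ∷ ys) u m with y ≟ z
      ... | yes P.refl = trans (*-cong refl (trans (Πl-choose-∉ z a 1# ys (Unique-head u)) (PM.Σl-0 ys))) (*-identityʳ a)
      ... | no ne with m
      ...   | here p = ⊥-elim (ne (P.sym p))
      ...   | there m' = trans (*-identityˡ _) (Πl-choose-once z a ys (Unique-tail u) m')

      Σl-choose-once : (z : X) (a b : Carrier) (xs : List X) → Unique xs → z ∈ xs → Σl xs (λ x → choose (x ≟ z) a b) + b ≈ a + Σl xs (λ _ → b)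
      Σl-choose-once z a b [] u ()
      Σl-choose-once z a b (y ∷ ys) u m with y ≟ z
      ... | yes P.refl = begin
            (a + Σl ys (λ x → choose (x ≟ y) a b)) + b ≈⟨ +-cong (+-cong refl (Σl-choose-∉ y a b ys (Unique-head u))) refl ⟩
            (a + Σl ys (λ _ → b)) + b ≈⟨ solve 3 (λ a s b → (a :+ s) :+ b := a :+ (b :+ s)) refl a (Σl ys (λ _ → b)) b ⟩
            a + (b + Σl ys (λ _ → b)) ∎
      ... | no ne with m
      ...   | here p = ⊥-elim (ne (P.sym p))
      ...   | there m' = begin
            (b + Σl ys (λ x → choose (x ≟ z) a b)) + b ≈⟨ +-assoc _ _ _ ⟩
            b + (Σl ys (λ x → choose (x ≟ z) a b) + b) ≈⟨ +-cong refl (Σl-choose-once z a b ys (Unique-tail u) m') ⟩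
            b + (a + Σl ys (λ _ → b)) ≈⟨ solve 3 (λ a s b → b :+ (a :+ s) := a :+ (b :+ s)) refl a (Σl ys (λ _ → b)) b ⟩
            a + (b + Σl ys (λ _ → b)) ∎

      -- Reindexing the product of the units e x (x ≠ z) along σ multiplies it by a^(|U| - 1).
      fermat-by-reindexing : (U : List X) → Unique U → (∀ x → x ∈ U) → (z : X) (e : X → Carrier) (σ τ : X → X) →
               (∀ x → τ (σ x) ≡ x) → (∀ x → σ (τ x) ≡ x) → σ z ≡ z → (a : Carrier) →
               (∀ x → ¬ x ≡ z → e (σ x) ≈ a * e x) → (∀ x → ¬ x ≡ z → Inv (e x)) → a ^ length U ≈ a
      fermat-by-reindexing U uU cU z e σ τ στ τσ σz a e∘σ≈a*e e-invertible = a^|U|≈a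
        where
        G : X → Carrier
        G x = choose (x ≟ z) 1# (e x)
        H : X → Carrier
        H x = choose (x ≟ z) 1# a
        H' : X → Carrier
        H' x = choose (x ≟ z) a 1#
        G∘σ≈H*G : ∀ x → G (σ x) ≈ H x * G x
        G∘σ≈H*G x with σ x ≟ z | x ≟ z
        ... | yes _ | yes _ = sym (*-identityˡ 1#)
        ... | no n | yes P.refl = ⊥-elim (n σz)
        ... | yes q | no n = ⊥-elim (n (P.trans (P.sym (στ x)) (P.trans (P.cong τ (P.trans q (P.sym σz))) (στ z))))
        ... | no _ | no n = e∘σ≈a*e x n
        G-invertible : ∀ x → x ∈ U → Inv (G x)
        G-invertible x _ with x ≟ z
        ... | yes _ = 1# , *-identityˡ 1#
        ... | no n = e-invertible x n
        ΠH : Πl U H ≈ 1#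
        ΠH = Πl-multiplier≈1 U uU cU σ τ στ τσ G H G∘σ≈H*G (Inv-Πl U G G-invertible)
        HH' : ∀ x → a ≈ H x * H' x
        HH' x with x ≟ z
        ... | yes _ = sym (*-identityˡ a)
        ... | no _ = sym (*-identityʳ a)
        a^|U|≈a : a ^ length U ≈ a
        a^|U|≈a = begin
          a ^ length U ≈⟨ sym (Πl-const U a) ⟩
          Πl U (λ _ → a) ≈⟨ PM.Σl-cong U HH' ⟩
          Πl U (λ x → H x * H' x) ≈⟨ Πl-* U H H' ⟩
          Πl U H * Πl U H' ≈⟨ *-cong ΠH (Πl-choose-once z a U uU (cU z)) ⟩
          1# * a ≈⟨ *-identityˡ a ⟩
          a ∎

    module ModIdeal (p : Carrier) where
      infix 4 _~_
      _~_ : Carrier → Carrier → Set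
      x ~ y = ∃ λ h → x ≈ y + h * p

      ≈⇒~ : ∀ {x y} → x ≈ y → x ~ y
      ≈⇒~ {x} {y} e = 0# , trans e (sym (trans (+-cong refl (zeroˡ p)) (+-identityʳ y)))

      ~refl : ∀ {x} → x ~ x
      ~refl = ≈⇒~ refl

      ~sym : ∀ {x y} → x ~ y → y ~ x
      ~sym {x} {y} (h , e) = (- h) , sym (begin
        x + (- h) * p ≈⟨ +-cong e refl ⟩
        (y + h * p) + (- h) * p ≈⟨ +-assoc _ _ _ ⟩
        y + (h * p + (- h) * p) ≈⟨ +-cong refl (sym (distribʳ p h (- h))) ⟩
        y + (h + - h) * p ≈⟨ +-cong refl (*-cong (-‿inverseʳ h) refl) ⟩
        y + 0# * p ≈⟨ +-cong refl (zeroˡ p) ⟩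
        y + 0# ≈⟨ +-identityʳ y ⟩
        y ∎)

      ~trans : ∀ {x y z} → x ~ y → y ~ z → x ~ z
      ~trans {x} {y} {z} (h , e) (k , e') = (k + h) , (begin
        x ≈⟨ e ⟩
        y + h * p ≈⟨ +-cong e' refl ⟩
        (z + k * p) + h * p ≈⟨ solve 4 (λ z k h p → (z :+ k :* p) :+ h :* p := z :+ (k :+ h) :* p) refl z k h p ⟩
        z + (k + h) * p ∎)

      ~+ : ∀ {x x' y y'} → x ~ x' → y ~ y' → (x + y) ~ (x' + y')
      ~+ {x} {x'} {y} {y'} (h , e) (k , e') = (h + k) , (begin
        x + y ≈⟨ +-cong e e' ⟩
        (x' + h * p) + (y' + k * p) ≈⟨ solve 5 (λ x' y' h k p → (x' :+ h :* p) :+ (y' :+ k :* p) := (x' :+ y') :+ (h :+ k) :* p) refl x' y' h k p ⟩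
        (x' + y') + (h + k) * p ∎)

      ~* : ∀ {x x' y y'} → x ~ x' → y ~ y' → (x * y) ~ (x' * y')
      ~* {x} {x'} {y} {y'} (h , e) (k , e') = (x' * k + h * y' + h * k * p) , (begin
        x * y ≈⟨ *-cong e e' ⟩
        (x' + h * p) * (y' + k * p) ≈⟨ solve 5 (λ x y h k p → (x :+ h :* p) :* (y :+ k :* p) := x :* y :+ (x :* k :+ h :* y :+ h :* k :* p) :* p) refl x' y' h k p ⟩
        x' * y' + (x' * k + h * y' + h * k * p) * p ∎)

      ~neg : ∀ {x x'} → x ~ x' → (- x) ~ (- x')
      ~neg {x} {x'} (h , e) = (- h) , (begin
        - x ≈⟨ -‿cong e ⟩
        - (x' + h * p) ≈⟨ sym (RP.-‿+-comm x' (h * p)) ⟩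
        - x' + - (h * p) ≈⟨ +-cong refl (RP.-‿distribˡ-* h p) ⟩
        - x' + (- h) * p ∎)

      quotientRing : CommutativeRing 0ℓ 0ℓ
      quotientRing = record
        { Carrier = Carrier ; _≈_ = _~_ ; _+_ = _+_ ; _*_ = _*_ ; -_ = -_ ; 0# = 0# ; 1# = 1#
        ; isCommutativeRing = record
          { isRing = record
            { +-isAbelianGroup = record
              { isGroup = record
                { isMonoid = record
                  { isSemigroup = record
                    { isMagma = record
                      { isEquivalence = record { refl = ~refl ; sym = ~sym ; trans = ~trans }
                      ; ∙-cong = ~+ }
                    ; assoc = λ x y z → ≈⇒~ (+-assoc x y z) }
                  ; identity = (λ x → ≈⇒~ (+-identityˡ x)) , (λ x → ≈⇒~ (+-identityʳ x)) }
                ; inverse = (λ x → ≈⇒~ (-‿inverseˡ x)) , (λ x → ≈⇒~ (-‿inverseʳ x))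
                ; ⁻¹-cong = ~neg }
              ; comm = λ x y → ≈⇒~ (+-comm x y) }
            ; *-cong = ~*
            ; *-assoc = λ x y z → ≈⇒~ (*-assoc x y z)
            ; *-identity = (λ x → ≈⇒~ (*-identityˡ x)) , (λ x → ≈⇒~ (*-identityʳ x))
            ; distrib = (λ x y z → ≈⇒~ (distribˡ x y z)) , (λ x y z → ≈⇒~ (distribʳ x y z)) }
          ; *-comm = λ x y → ≈⇒~ (*-comm x y) } }


module Polynomials where

  open import Level using (0ℓ)
  open import Algebra.Bundles using (CommutativeRing)
  open import Algebra.Structures
  open import Data.Nat using (zero; suc)
  open import Data.List using ([]; _∷_)
  open import Data.Product using (_,_)
  open import Relation.Binary.PropositionalEquality as P using (_≡_; refl; cong; cong₂)
  open import Defs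

  module PolynomialRing (F : FiniteField) where
    open FiniteField F public
    open Over F public
    module R = CommutativeRing ring
    open R using (Carrier; _+_; _*_; -_; 0#; 1#)
    import Algebra.Properties.Ring
    module RPr = Algebra.Properties.Ring R.ring

    -- Defs' _≈ₚ_ wrapped in a record, so that f and g can be inferred from a proof of f ≋ g.
    infix 4 _≋_
    record _≋_ (f g : Poly) : Set where
      constructor pw
      field at : ∀ i → coeff f i ≡ coeff g i
    open _≋_ public

    ≋refl : ∀ {f} → f ≋ f
    ≋refl = pw λ i → refl
    ≋sym : ∀ {f g} → f ≋ g → g ≋ f
    ≋sym e = pw λ i → P.sym (at e i)
    ≋trans : ∀ {f g h} → f ≋ g → g ≋ h → f ≋ h
    ≋trans e e' = pw λ i → P.trans (at e i) (at e' i)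

    coeff-+ : ∀ f g i → coeff (f +ₚ g) i ≡ coeff f i + coeff g i
    coeff-+ [] g i = P.sym (≈⇒≡ (R.+-identityˡ _))
    coeff-+ (x ∷ f) [] i = P.sym (≈⇒≡ (R.+-identityʳ _))
    coeff-+ (x ∷ f) (y ∷ g) zero = refl
    coeff-+ (x ∷ f) (y ∷ g) (suc i) = coeff-+ f g i

    coeff-neg : ∀ f i → coeff (negₚ f) i ≡ - coeff f i
    coeff-neg [] i = P.sym (≈⇒≡ RPr.-0#≈0#)
    coeff-neg (x ∷ f) zero = refl
    coeff-neg (x ∷ f) (suc i) = coeff-neg f i

    coeff-scale : ∀ c f i → coeff (scale c f) i ≡ c * coeff f i
    coeff-scale c [] i = P.sym (≈⇒≡ (R.zeroʳ c))
    coeff-scale c (x ∷ f) zero = refl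
    coeff-scale c (x ∷ f) (suc i) = coeff-scale c f i

    cons-cong : ∀ {x y f g} → x ≡ y → f ≋ g → (x ∷ f) ≋ (y ∷ g)
    cons-cong e e' = pw λ { zero → e ; (suc i) → at e' i }

    tail≋ : ∀ {x y f g} → (x ∷ f) ≋ (y ∷ g) → f ≋ g
    tail≋ e = pw λ i → at e (suc i)

    +ₚ-cong : ∀ {f f' g g'} → f ≋ f' → g ≋ g' → (f +ₚ g) ≋ (f' +ₚ g')
    +ₚ-cong {f} {f'} {g} {g'} e e' = pw λ i → P.trans (coeff-+ f g i) (P.trans (cong₂ _+_ (at e i) (at e' i)) (P.sym (coeff-+ f' g' i)))

    +ₚ-assoc : ∀ f g h → ((f +ₚ g) +ₚ h) ≋ (f +ₚ (g +ₚ h))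
    +ₚ-assoc f g h = pw λ i → P.trans (coeff-+ (f +ₚ g) h i) (P.trans (cong (_+ coeff h i) (coeff-+ f g i))
      (P.trans (≈⇒≡ (R.+-assoc _ _ _)) (P.trans (cong (coeff f i +_) (P.sym (coeff-+ g h i))) (P.sym (coeff-+ f (g +ₚ h) i)))))

    +ₚ-comm : ∀ f g → (f +ₚ g) ≋ (g +ₚ f)
    +ₚ-comm f g = pw λ i → P.trans (coeff-+ f g i) (P.trans (≈⇒≡ (R.+-comm _ _)) (P.sym (coeff-+ g f i)))

    +ₚ-idˡ : ∀ f → ([] +ₚ f) ≋ f
    +ₚ-idˡ f = ≋refl

    +ₚ-idʳ : ∀ f → (f +ₚ []) ≋ f
    +ₚ-idʳ f = pw λ i → P.trans (coeff-+ f [] i) (≈⇒≡ (R.+-identityʳ _))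

    negₚ-cong : ∀ {f g} → f ≋ g → negₚ f ≋ negₚ g
    negₚ-cong {f} {g} e = pw λ i → P.trans (coeff-neg f i) (P.trans (cong -_ (at e i)) (P.sym (coeff-neg g i)))

    negₚ-invˡ : ∀ f → (negₚ f +ₚ f) ≋ []
    negₚ-invˡ f = pw λ i → P.trans (coeff-+ (negₚ f) f i) (P.trans (cong (_+ coeff f i) (coeff-neg f i)) (≈⇒≡ (R.-‿inverseˡ _)))

    negₚ-invʳ : ∀ f → (f +ₚ negₚ f) ≋ []
    negₚ-invʳ f = pw λ i → P.trans (coeff-+ f (negₚ f) i) (P.trans (cong (coeff f i +_) (coeff-neg f i)) (≈⇒≡ (R.-‿inverseʳ _)))

    scale-congˡ : ∀ {x y} g → x ≡ y → scale x g ≋ scale y g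
    scale-congˡ g refl = ≋refl

    scale-congʳ : ∀ x {g g'} → g ≋ g' → scale x g ≋ scale x g'
    scale-congʳ x {g} {g'} e = pw λ i → P.trans (coeff-scale x g i) (P.trans (cong (x *_) (at e i)) (P.sym (coeff-scale x g' i)))

    scale-zero : ∀ g → scale 0# g ≋ []
    scale-zero g = pw λ i → P.trans (coeff-scale 0# g i) (≈⇒≡ (R.zeroˡ _))

    scale-one : ∀ g → scale 1# g ≋ g
    scale-one g = pw λ i → P.trans (coeff-scale 1# g i) (≈⇒≡ (R.*-identityˡ _))

    scale-+ : ∀ x g h → scale x (g +ₚ h) ≋ (scale x g +ₚ scale x h)
    scale-+ x g h = pw λ i → P.trans (coeff-scale x (g +ₚ h) i) (P.trans (cong (x *_) (coeff-+ g h i))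
       (P.trans (≈⇒≡ (R.distribˡ _ _ _)) (P.sym (P.trans (coeff-+ (scale x g) (scale x h) i) (cong₂ _+_ (coeff-scale x g i) (coeff-scale x h i))))))

    scale-scale : ∀ x y g → scale x (scale y g) ≋ scale (x * y) g
    scale-scale x y g = pw λ i → P.trans (coeff-scale x (scale y g) i) (P.trans (cong (x *_) (coeff-scale y g i))
       (P.trans (≈⇒≡ (R.sym (R.*-assoc _ _ _))) (P.sym (coeff-scale (x * y) g i))))

    +ₚ-swap : ∀ a b c → (a +ₚ (b +ₚ c)) ≋ (b +ₚ (a +ₚ c))
    +ₚ-swap a b c = ≋trans (≋sym (+ₚ-assoc a b c)) (≋trans (+ₚ-cong (+ₚ-comm a b) (≋refl {c})) (+ₚ-assoc b a c))

    +ₚ-swap4 : ∀ a b c d → ((a +ₚ b) +ₚ (c +ₚ d)) ≋ ((a +ₚ c) +ₚ (b +ₚ d))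
    +ₚ-swap4 a b c d = ≋trans (+ₚ-assoc a b (c +ₚ d)) (≋trans (+ₚ-cong (≋refl {a}) (+ₚ-swap b c d)) (≋sym (+ₚ-assoc a c (b +ₚ d))))

    0#∷-+ₚ : ∀ a b → (0# ∷ (a +ₚ b)) ≋ ((0# ∷ a) +ₚ (0# ∷ b))
    0#∷-+ₚ a b = pw λ { zero → P.sym (≈⇒≡ (R.+-identityˡ _)) ; (suc i) → refl }

    []+[0#]≋[] : ([] +ₚ (0# ∷ [])) ≋ []
    []+[0#]≋[] = pw λ { zero → refl ; (suc i) → refl }

    *ₚ-zeroˡ : ∀ f g → f ≋ [] → (f *ₚ g) ≋ []
    *ₚ-zeroˡ [] g e = ≋refl
    *ₚ-zeroˡ (x ∷ f) g e = ≋trans (+ₚ-cong (≋trans (scale-congˡ g (at e zero)) (scale-zero g)) (cons-cong {0#} {0#} refl (*ₚ-zeroˡ f g (pw λ i → at e (suc i))))) []+[0#]≋[]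

    *ₚ-congˡ : ∀ {f f'} g → f ≋ f' → (f *ₚ g) ≋ (f' *ₚ g)
    *ₚ-congˡ {[]} {f'} g e = ≋sym (*ₚ-zeroˡ f' g (≋sym e))
    *ₚ-congˡ {x ∷ f} {[]} g e = *ₚ-zeroˡ (x ∷ f) g e
    *ₚ-congˡ {x ∷ f} {x' ∷ f'} g e = +ₚ-cong (scale-congˡ g (at e zero)) (cons-cong {0#} {0#} refl (*ₚ-congˡ g (tail≋ e)))

    *ₚ-congʳ : ∀ f {g g'} → g ≋ g' → (f *ₚ g) ≋ (f *ₚ g')
    *ₚ-congʳ [] e = ≋refl
    *ₚ-congʳ (x ∷ f) e = +ₚ-cong (scale-congʳ x e) (cons-cong {0#} {0#} refl (*ₚ-congʳ f e))

    *ₚ-zeroʳ : ∀ f → (f *ₚ []) ≋ []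
    *ₚ-zeroʳ [] = ≋refl
    *ₚ-zeroʳ (x ∷ f) = pw λ { zero → refl ; (suc i) → at (*ₚ-zeroʳ f) i }

    *ₚ-∷ : ∀ f y g → (f *ₚ (y ∷ g)) ≋ (scale y f +ₚ (0# ∷ (f *ₚ g)))
    *ₚ-∷ [] y g = pw λ { zero → refl ; (suc i) → refl }
    *ₚ-∷ (x ∷ f) y g = cons-cong (cong (_+ 0#) (≈⇒≡ (R.*-comm x y)))
       (≋trans (+ₚ-cong (≋refl {scale x g}) (*ₚ-∷ f y g)) (+ₚ-swap (scale x g) (scale y f) (0# ∷ (f *ₚ g))))

    *ₚ-comm : ∀ f g → (f *ₚ g) ≋ (g *ₚ f)
    *ₚ-comm [] g = ≋sym (*ₚ-zeroʳ g)
    *ₚ-comm (x ∷ f) g = ≋trans (+ₚ-cong (≋refl {scale x g}) (cons-cong {0#} {0#} refl (*ₚ-comm f g))) (≋sym (*ₚ-∷ g x f))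

    *ₚ-distribˡ : ∀ f g h → (f *ₚ (g +ₚ h)) ≋ ((f *ₚ g) +ₚ (f *ₚ h))
    *ₚ-distribˡ [] g h = ≋refl
    *ₚ-distribˡ (x ∷ f) g h = ≋trans (+ₚ-cong (scale-+ x g h) (≋trans (cons-cong {0#} {0#} refl (*ₚ-distribˡ f g h)) (0#∷-+ₚ (f *ₚ g) (f *ₚ h))))
       (+ₚ-swap4 (scale x g) (scale x h) (0# ∷ (f *ₚ g)) (0# ∷ (f *ₚ h)))

    *ₚ-distribʳ : ∀ h f g → ((f +ₚ g) *ₚ h) ≋ ((f *ₚ h) +ₚ (g *ₚ h))
    *ₚ-distribʳ h f g = ≋trans (*ₚ-comm (f +ₚ g) h) (≋trans (*ₚ-distribˡ h f g) (+ₚ-cong (*ₚ-comm h f) (*ₚ-comm h g)))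

    scale-0#∷ : ∀ x u → scale x (0# ∷ u) ≋ (0# ∷ scale x u)
    scale-0#∷ x u = cons-cong (≈⇒≡ (R.zeroʳ x)) ≋refl

    0#∷-*ₚ : ∀ u h → ((0# ∷ u) *ₚ h) ≋ (0# ∷ (u *ₚ h))
    0#∷-*ₚ u h = ≋trans (+ₚ-cong (scale-zero h) (≋refl {0# ∷ (u *ₚ h)})) (+ₚ-idˡ _)

    scale-mul : ∀ x g h → ((scale x g) *ₚ h) ≋ scale x (g *ₚ h)
    scale-mul x [] h = ≋refl
    scale-mul x (y ∷ g) h = ≋trans (+ₚ-cong (≋sym (scale-scale x y h)) (cons-cong {0#} {0#} refl (scale-mul x g h)))
       (≋sym (≋trans (scale-+ x (scale y h) (0# ∷ (g *ₚ h))) (+ₚ-cong (≋refl {scale x (scale y h)}) (scale-0#∷ x (g *ₚ h)))))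

    *ₚ-assoc : ∀ f g h → ((f *ₚ g) *ₚ h) ≋ (f *ₚ (g *ₚ h))
    *ₚ-assoc [] g h = ≋refl
    *ₚ-assoc (x ∷ f) g h = ≋trans (*ₚ-distribʳ h (scale x g) (0# ∷ (f *ₚ g)))
       (+ₚ-cong (scale-mul x g h) (≋trans (0#∷-*ₚ (f *ₚ g) h) (cons-cong {0#} {0#} refl (*ₚ-assoc f g h))))

    coeff-[0#] : ∀ i → coeff (0# ∷ []) i ≡ 0#
    coeff-[0#] zero = refl
    coeff-[0#] (suc i) = refl

    *ₚ-idˡ : ∀ g → (oneₚ *ₚ g) ≋ g
    *ₚ-idˡ g = ≋trans (+ₚ-cong (scale-one g) (≋refl {0# ∷ []})) (≋trans (+ₚ-comm g (0# ∷ [])) z)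
      where
      z : ((0# ∷ []) +ₚ g) ≋ g
      z = pw λ i → P.trans (coeff-+ (0# ∷ []) g i) (P.trans (cong (_+ coeff g i) (coeff-[0#] i)) (≈⇒≡ (R.+-identityˡ _)))

    *ₚ-idʳ : ∀ g → (g *ₚ oneₚ) ≋ g
    *ₚ-idʳ g = ≋trans (*ₚ-comm g oneₚ) (*ₚ-idˡ g)

    A : CommutativeRing 0ℓ 0ℓ
    A = record
      { Carrier = Poly ; _≈_ = _≋_ ; _+_ = _+ₚ_ ; _*_ = _*ₚ_ ; -_ = negₚ ; 0# = zeroₚ ; 1# = oneₚ
      ; isCommutativeRing = record
        { isRing = record
          { +-isAbelianGroup = record
            { isGroup = record
              { isMonoid = record
                { isSemigroup = record
                  { isMagma = record
                    { isEquivalence = record { refl = ≋refl ; sym = ≋sym ; trans = ≋trans }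
                    ; ∙-cong = +ₚ-cong }
                  ; assoc = +ₚ-assoc }
                ; identity = +ₚ-idˡ , +ₚ-idʳ }
              ; inverse = negₚ-invˡ , negₚ-invʳ
              ; ⁻¹-cong = negₚ-cong }
            ; comm = +ₚ-comm }
          ; *-cong = λ {f} {f'} {g} {g'} e e' → ≋trans (*ₚ-congˡ g e) (*ₚ-congʳ f' e')
          ; *-assoc = *ₚ-assoc
          ; *-identity = *ₚ-idˡ , *ₚ-idʳ
          ; distrib = (λ f g h → *ₚ-distribˡ f g h) , (λ h f g → *ₚ-distribʳ h f g) }
        ; *-comm = *ₚ-comm } }


module FiniteFields where

  open import Algebra.Bundles using (CommutativeRing)
  open import Data.Nat as ℕ using (ℕ; zero; suc; _≤_; _<_; z≤n; s≤s; _∸_)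
  import Data.Nat.Properties as NP
  open import Data.Fin as Fin using (Fin)
  open import Data.List using (List; []; _∷_; length)
  open import Data.List.Relation.Unary.Any as Any using (Any; here; there)
  open import Data.List.Relation.Unary.Any.Properties using (lookup-index)
  open import Data.List.Relation.Unary.All as All using (All; []; _∷_)
  open import Data.List.Relation.Unary.AllPairs using ([]; _∷_)
  open import Data.List.Membership.Propositional using (_∈_; _∉_)
  open import Data.List.Relation.Unary.Unique.Propositional using (Unique)
  open import Data.Product using (∃; _×_; _,_; proj₁; proj₂)
  open import Data.Sum using (_⊎_; inj₁; inj₂)
  open import Data.Empty using (⊥-elim)
  open import Relation.Nullary using (¬_; Dec; yes; no)
  open import Relation.Binary.PropositionalEquality as P using (_≡_; refl; cong; cong₂)
  open import Defs
  open ListSums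
  open CommutativeRings
  open Polynomials
  import Algebra.Properties.CommutativeSemiring.Binomial
  import Algebra.Properties.Semiring.Sum
  import Algebra.Properties.Semiring.Mult
  import Data.Fin.Properties
  import Data.Fin

  module FieldLemmas (F : FiniteField) where
    open PolynomialRing F public
    module KF = RingLemmas ring
    module KA = RingLemmas A
    open R using (Carrier; _+_; _*_; -_; 0#; 1#) renaming (_≈_ to _≈F_)
    open import Algebra.Solver.Ring.NaturalCoefficients.Default R.commutativeSemiring using (solve; _:=_; _:+_; _:*_)

    ec : ∀ x → x ∈ elems
    ec = elems-complete

    infix 4 _≟_
    _≟_ : (x y : Carrier) → Dec (x ≡ y)
    x ≟ y with Fin._≟_ (Any.index (ec x)) (Any.index (ec y))
    ... | yes e = yes (P.trans (lookup-index (ec x)) (P.trans (cong (Data.List.lookup elems) e) (P.sym (lookup-index (ec y)))))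
    ... | no ne = no (λ { refl → ne refl })

    q≥2 : ∃ λ b → q ≡ suc (suc b)
    q≥2 = go elems (ec 0#) (ec 1#)
      where
      go : (xs : List Carrier) → 0# ∈ xs → 1# ∈ xs → ∃ λ b → length xs ≡ suc (suc b)
      go (x ∷ y ∷ xs) _ _ = length xs , refl
      go (x ∷ []) (here p) (here p') = ⊥-elim (0≢1 (P.trans p (P.sym p')))
      go (x ∷ []) (here p) (there ())
      go (x ∷ []) (there ()) _

    inv : (x : Carrier) → ¬ x ≡ 0# → Carrier
    inv x nz = proj₁ (inverse x nz)

    inv-r : (x : Carrier) (nz : ¬ x ≡ 0#) → x * inv x nz ≡ 1#
    inv-r x nz = proj₂ (inverse x nz)

    inv-cancelˡ : ∀ c (nz : ¬ c ≡ 0#) x → inv c nz * (c * x) ≡ x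
    inv-cancelˡ c nz x = ≈⇒≡ (R.trans (R.sym (R.*-assoc _ _ _)) (R.trans (R.*-cong (R.trans (R.*-comm _ _) (R.reflexive (inv-r c nz))) R.refl) (R.*-identityˡ x)))

    inv-cancelʳ : ∀ c (nz : ¬ c ≡ 0#) x → c * (inv c nz * x) ≡ x
    inv-cancelʳ c nz x = ≈⇒≡ (R.trans (R.sym (R.*-assoc _ _ _)) (R.trans (R.*-cong (R.reflexive (inv-r c nz)) R.refl) (R.*-identityˡ x)))

    inv-nonzero : ∀ c (nz : ¬ c ≡ 0#) → ¬ inv c nz ≡ 0#
    inv-nonzero c nz e = 0≢1 (P.trans (P.sym (≈⇒≡ (R.trans (R.*-cong R.refl (R.reflexive e)) (R.zeroʳ c)))) (inv-r c nz))

    *≡0⇒ : ∀ {x y} → x * y ≡ 0# → x ≡ 0# ⊎ y ≡ 0#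
    *≡0⇒ {x} {y} e with x ≟ 0#
    ... | yes p = inj₁ p
    ... | no np = inj₂ (≈⇒≡ (KF.cancelˡ (inv x np , R.reflexive (inv-r x np)) (R.trans (R.reflexive e) (R.sym (R.zeroʳ x)))))

    eval : Poly → Carrier → Carrier
    eval [] c = 0#
    eval (x ∷ f) c = x + c * eval f c

    eval-≋[] : ∀ f c → f ≋ [] → eval f c ≡ 0#
    eval-≋[] [] c e = refl
    eval-≋[] (x ∷ f) c e = P.trans (cong₂ (λ a b → a + c * b) (at e zero) (eval-≋[] f c (pw λ i → at e (suc i))))
                            (≈⇒≡ (R.trans (R.+-identityˡ _) (R.zeroʳ c)))

    eval-cong : ∀ {f g} c → f ≋ g → eval f c ≡ eval g c
    eval-cong {[]} {g} c e = P.sym (eval-≋[] g c (≋sym e))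
    eval-cong {x ∷ f} {[]} c e = eval-≋[] (x ∷ f) c e
    eval-cong {x ∷ f} {y ∷ g} c e = cong₂ (λ a b → a + c * b) (at e zero) (eval-cong c (tail≋ e))

    eval-+ : ∀ f g c → eval (f +ₚ g) c ≡ eval f c + eval g c
    eval-+ [] g c = P.sym (≈⇒≡ (R.+-identityˡ _))
    eval-+ (x ∷ f) [] c = P.sym (≈⇒≡ (R.+-identityʳ _))
    eval-+ (x ∷ f) (y ∷ g) c = P.trans (cong (λ b → (x + y) + c * b) (eval-+ f g c))
       (≈⇒≡ (solve 5 (λ x y c a b → (x :+ y) :+ c :* (a :+ b) := (x :+ c :* a) :+ (y :+ c :* b)) R.refl x y c (eval f c) (eval g c)))

    eval-scale : ∀ x f c → eval (scale x f) c ≡ x * eval f c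
    eval-scale x [] c = P.sym (≈⇒≡ (R.zeroʳ x))
    eval-scale x (y ∷ f) c = P.trans (cong (λ b → x * y + c * b) (eval-scale x f c))
       (≈⇒≡ (solve 4 (λ x y c a → x :* y :+ c :* (x :* a) := x :* (y :+ c :* a)) R.refl x y c (eval f c)))

    eval-* : ∀ f g c → eval (f *ₚ g) c ≡ eval f c * eval g c
    eval-* [] g c = P.sym (≈⇒≡ (R.zeroˡ _))
    eval-* (x ∷ f) g c = begin
        eval (scale x g +ₚ (0# ∷ (f *ₚ g))) c ≡⟨ eval-+ (scale x g) (0# ∷ (f *ₚ g)) c ⟩
        eval (scale x g) c + (0# + c * eval (f *ₚ g) c) ≡⟨ cong₂ (λ a b → a + (0# + c * b)) (eval-scale x g c) (eval-* f g c) ⟩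
        x * eval g c + (0# + c * (eval f c * eval g c)) ≡⟨ cong (λ z → x * eval g c + z) (≈⇒≡ (R.+-identityˡ _)) ⟩
        x * eval g c + c * (eval f c * eval g c) ≡⟨ ≈⇒≡ (solve 4 (λ x c a b → x :* b :+ c :* (a :* b) := (x :+ c :* a) :* b) R.refl x c (eval f c) (eval g c)) ⟩
        (x + c * eval f c) * eval g c ∎
      where open P.≡-Reasoning

    eval-neg : ∀ f c → eval (negₚ f) c ≡ - eval f c
    eval-neg [] c = P.sym (≈⇒≡ KF.RP.-0#≈0#)
    eval-neg (x ∷ f) c = P.trans (cong (λ b → - x + c * b) (eval-neg f c))
       (≈⇒≡ (R.trans (R.+-cong R.refl (R.sym (KF.RP.-‿distribʳ-* c (eval f c)))) (KF.RP.-‿+-comm x (c * eval f c))))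

    eval-one : ∀ c → eval oneₚ c ≡ 1#
    eval-one c = ≈⇒≡ (R.trans (R.+-cong R.refl (R.zeroʳ c)) (R.+-identityʳ 1#))

    eval-^ : ∀ f k c → eval (f ^ₚ k) c ≡ eval f c KF.^ k
    eval-^ f zero c = eval-one c
    eval-^ f (suc k) c = P.trans (eval-* f (f ^ₚ k) c) (cong (eval f c *_) (eval-^ f k c))

    DegreeBelow : ℕ → Poly → Set
    DegreeBelow k f = ∀ i → k ≤ i → coeff f i ≡ 0#

    DegreeBelow-0 : ∀ f → DegreeBelow 0 f → f ≋ []
    DegreeBelow-0 f b = pw λ i → b i z≤n

    linear : Carrier → Poly
    linear c = (- c) ∷ 1# ∷ []

    synDiv : Carrier → Poly → Poly
    synDiv c [] = []
    synDiv c (a ∷ f) = eval f c ∷ synDiv c f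

    synDiv-spec : ∀ c f → f ≋ ((linear c *ₚ synDiv c f) +ₚ (eval f c ∷ []))
    synDiv-spec c [] = ≋sym (≋trans (+ₚ-cong (*ₚ-zeroʳ (linear c)) (≋refl {0# ∷ []})) []+[0#]≋[])
    synDiv-spec c (a ∷ f) = ≋trans (cons-cong hd tl) (≋sym (+ₚ-cong (*ₚ-∷ (linear c) r g) (≋refl {(a + c * r) ∷ []})))
      where
      r = eval f c
      g = synDiv c f
      hd : a ≡ ((r * (- c)) + 0#) + (a + c * r)
      hd = ≈⇒≡ (R.sym (begin
        ((r * (- c)) + 0#) + (a + c * r) ≈⟨ R.+-cong (R.+-identityʳ _) R.refl ⟩
        (r * (- c)) + (a + c * r) ≈⟨ R.+-cong (R.sym (KF.RP.-‿distribʳ-* r c)) R.refl ⟩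
        - (r * c) + (a + c * r) ≈⟨ R.+-cong R.refl (R.+-cong R.refl (R.*-comm c r)) ⟩
        - (r * c) + (a + r * c) ≈⟨ R.+-cong R.refl (R.+-comm a _) ⟩
        - (r * c) + (r * c + a) ≈⟨ R.sym (R.+-assoc _ _ _) ⟩
        (- (r * c) + r * c) + a ≈⟨ R.+-cong (R.-‿inverseˡ _) R.refl ⟩
        0# + a ≈⟨ R.+-identityˡ a ⟩
        a ∎))
        where open import Relation.Binary.Reasoning.Setoid R.setoid
      tl : f ≋ (((r * 1#) ∷ []) +ₚ (linear c *ₚ g)) +ₚ []
      tl = ≋trans (synDiv-spec c f) (≋trans (+ₚ-comm (linear c *ₚ g) (r ∷ [])) (≋trans (+ₚ-cong (cons-cong (P.sym (≈⇒≡ (R.*-identityʳ r))) ≋refl) (≋refl {linear c *ₚ g})) (≋sym (+ₚ-idʳ _))))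

    synDiv-degree : ∀ c k f → DegreeBelow (suc k) f → DegreeBelow k (synDiv c f)
    synDiv-degree c k [] b i le = refl
    synDiv-degree c zero (a ∷ f) b zero le = eval-≋[] f c (DegreeBelow-0 f (λ i le → b (suc i) (s≤s le)))
    synDiv-degree c zero (a ∷ f) b (suc i) le = synDiv-degree c zero f (λ j le' → b (suc j) (s≤s z≤n)) i z≤n
    synDiv-degree c (suc k) (a ∷ f) b zero ()
    synDiv-degree c (suc k) (a ∷ f) b (suc i) (s≤s le) = synDiv-degree c k f (λ j le' → b (suc j) (s≤s le')) i le

    linear-root : ∀ c c' → eval (linear c) c' ≡ 0# → c' ≡ c
    linear-root c c' e = ≈⇒≡ (KF.RP.x∙y⁻¹≈ε⇒x≈y c' c (R.trans (R.+-comm c' (- c)) (R.trans (R.+-cong R.refl (R.reflexive lc)) (R.reflexive e))))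
      where
      lc : c' ≡ c' * (1# + c' * 0#)
      lc = ≈⇒≡ (R.sym (R.trans (R.*-cong R.refl (R.trans (R.+-cong R.refl (R.zeroʳ c')) (R.+-identityʳ 1#))) (R.*-identityʳ c')))

    DegreeBelow-roots⇒≋[] : ∀ k f → DegreeBelow k f → (cs : List Carrier) → Unique cs → All (λ c → eval f c ≡ 0#) cs → k ≤ length cs → f ≋ []
    DegreeBelow-roots⇒≋[] zero f b cs u r le = DegreeBelow-0 f b
    DegreeBelow-roots⇒≋[] (suc k) f b [] u r ()
    DegreeBelow-roots⇒≋[] (suc k) f b (c ∷ cs) (a ∷ u) (r ∷ rs) (s≤s le) = ≋trans fg (≋trans (*ₚ-congʳ (linear c) g0) (*ₚ-zeroʳ (linear c)))
      where
      g = synDiv c f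
      fg : f ≋ (linear c *ₚ g)
      fg = ≋trans (synDiv-spec c f) (≋trans (+ₚ-cong (≋refl {linear c *ₚ g}) (pw λ { zero → r ; (suc i) → refl })) (+ₚ-idʳ _))
      h : ∀ {c'} → ¬ c ≡ c' → eval f c' ≡ 0# → eval g c' ≡ 0#
      h {c'} ne e with *≡0⇒ (P.trans (P.sym (eval-* (linear c) g c')) (P.trans (P.sym (eval-cong c' fg)) e))
      ... | inj₁ p = ⊥-elim (ne (P.sym (linear-root c c' p)))
      ... | inj₂ p = p
      go : ∀ {ys} → All (λ y → ¬ c ≡ y) ys → All (λ y → eval f y ≡ 0#) ys → All (λ y → eval g y ≡ 0#) ys
      go [] [] = []
      go (n ∷ ns) (e ∷ es) = h n e ∷ go ns es
      g0 : g ≋ []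
      g0 = DegreeBelow-roots⇒≋[] k g (synDiv-degree c k f b) cs u (go a rs) le

    θ : Poly
    θ = 0# ∷ 1# ∷ []

    θ-mul : ∀ f → (θ *ₚ f) ≋ (0# ∷ f)
    θ-mul f = ≋trans (+ₚ-cong (scale-zero f) (cons-cong {0#} {0#} refl (*ₚ-idˡ f))) (+ₚ-idˡ _)

    coeff-θ^k : ∀ k → coeff (θ ^ₚ k) k ≡ 1#
    coeff-θ^k zero = refl
    coeff-θ^k (suc k) = P.trans (at (θ-mul (θ ^ₚ k)) (suc k)) (coeff-θ^k k)

    coeff-θ^k-≢ : ∀ k i → ¬ i ≡ k → coeff (θ ^ₚ k) i ≡ 0#
    coeff-θ^k-≢ zero zero ne = ⊥-elim (ne refl)
    coeff-θ^k-≢ zero (suc i) ne = refl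
    coeff-θ^k-≢ (suc k) zero ne = at (θ-mul (θ ^ₚ k)) zero
    coeff-θ^k-≢ (suc k) (suc i) ne = P.trans (at (θ-mul (θ ^ₚ k)) (suc i)) (coeff-θ^k-≢ k i (λ e → ne (cong suc e)))

    eval-θ : ∀ c → eval θ c ≡ c
    eval-θ c = ≈⇒≡ (R.trans (R.+-identityˡ _) (R.trans (R.*-cong R.refl (R.trans (R.+-cong R.refl (R.zeroʳ c)) (R.+-identityʳ 1#))) (R.*-identityʳ c)))

    remove : Carrier → List Carrier → List Carrier
    remove z [] = []
    remove z (y ∷ ys) with y ≟ z
    ... | yes _ = remove z ys
    ... | no _ = y ∷ remove z ys

    remove-∈⁻ : ∀ z ys {x} → x ∈ remove z ys → x ∈ ys × ¬ x ≡ z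
    remove-∈⁻ z [] ()
    remove-∈⁻ z (y ∷ ys) m with y ≟ z
    remove-∈⁻ z (y ∷ ys) m | yes _ with remove-∈⁻ z ys m
    ... | m' , n = there m' , n
    remove-∈⁻ z (y ∷ ys) (here refl) | no n = here refl , n
    remove-∈⁻ z (y ∷ ys) (there m) | no n with remove-∈⁻ z ys m
    ... | m' , n' = there m' , n'

    remove-All : ∀ {Q : Carrier → Set} z ys → All Q ys → All Q (remove z ys)
    remove-All z [] [] = []
    remove-All z (y ∷ ys) (p ∷ ps) with y ≟ z
    ... | yes _ = remove-All z ys ps
    ... | no _ = p ∷ remove-All z ys ps

    remove-Unique : ∀ z ys → Unique ys → Unique (remove z ys)
    remove-Unique z [] u = []
    remove-Unique z (y ∷ ys) (a ∷ u) with y ≟ z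
    ... | yes _ = remove-Unique z ys u
    ... | no _ = remove-All z ys a ∷ remove-Unique z ys u

    remove-∉ : ∀ z ys → z ∉ ys → remove z ys ≡ ys
    remove-∉ z [] n = refl
    remove-∉ z (y ∷ ys) n with y ≟ z
    ... | yes refl = ⊥-elim (n (here refl))
    ... | no _ = cong (y ∷_) (remove-∉ z ys (λ m → n (there m)))

    remove-length : ∀ z ys → Unique ys → z ∈ ys → suc (length (remove z ys)) ≡ length ys
    remove-length z (y ∷ ys) u m with y ≟ z
    remove-length z (y ∷ ys) u m | yes refl = cong (λ l → suc (length l)) (remove-∉ y ys (Unique-head u))
    remove-length z (y ∷ ys) u (here refl) | no n = ⊥-elim (n refl)
    remove-length z (y ∷ ys) u (there m) | no n = cong suc (remove-length z ys (Unique-tail u) m)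

    nonzeros : List Carrier
    nonzeros = remove 0# elems

    nonzeros-length : suc (length nonzeros) ≡ q
    nonzeros-length = remove-length 0# elems elems-unique (ec 0#)

    open KF using (_^_)
    open import Algebra.Properties.CommutativeSemiring.Exp R.commutativeSemiring using (^-distrib-*)

    Σ-1≈0 : KF.Σl elems (λ _ → 1#) ≈F 0#
    Σ-1≈0 = KF.RP.+-cancelˡ S _ _ (R.trans eq (R.sym (R.+-identityʳ S)))
      where
      S = KF.Σl elems (λ x → x)
      l1 : ∀ x → (x + 1#) + - 1# ≡ x
      l1 x = ≈⇒≡ (R.trans (R.+-assoc _ _ _) (R.trans (R.+-cong R.refl (R.-‿inverseʳ 1#)) (R.+-identityʳ x)))
      l2 : ∀ x → (x + - 1#) + 1# ≡ x
      l2 x = ≈⇒≡ (R.trans (R.+-assoc _ _ _) (R.trans (R.+-cong R.refl (R.-‿inverseˡ 1#)) (R.+-identityʳ x)))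
      eq : S + KF.Σl elems (λ _ → 1#) ≈F S
      eq = R.trans (R.sym (KF.Σl-+ elems (λ x → x) (λ _ → 1#))) (KF.Σl-reindex elems elems-unique ec (_+ 1#) (_+ (- 1#)) l1 l2 (λ x → x))

    find-pow≢1 : ∀ k (xs : List Carrier) → (∃ λ x → ¬ x ≡ 0# × ¬ (x ^ k) ≡ 1#) ⊎ (∀ x → x ∈ xs → ¬ x ≡ 0# → (x ^ k) ≡ 1#)
    find-pow≢1 k [] = inj₂ (λ x ())
    find-pow≢1 k (y ∷ ys) with y ≟ 0# | (y ^ k) ≟ 1# | find-pow≢1 k ys
    ... | yes y0 | _ | inj₁ r = inj₁ r
    ... | yes y0 | _ | inj₂ a = inj₂ (λ { x (here refl) n → ⊥-elim (n y0) ; x (there m) n → a x m n })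
    ... | no n0 | yes e | inj₁ r = inj₁ r
    ... | no n0 | yes e | inj₂ a = inj₂ (λ { x (here refl) n → e ; x (there m) n → a x m n })
    ... | no n0 | no ne | _ = inj₁ (y , n0 , ne)

    -- Either some l ≠ 0 has l^k ≠ 1, and reindexing x ↦ l x gives l^k S = S, or θ^k - 1 has
    -- q - 1 > k roots.
    powerSum≈0 : ∀ k → suc k < q → KF.Σl elems (λ x → x ^ k) ≈F 0#
    powerSum≈0 zero lt = Σ-1≈0
    powerSum≈0 (suc k) lt with find-pow≢1 (suc k) elems
    ... | inj₂ all = ⊥-elim (0≢1 (P.sym contra))
      where
      k' = suc k
      h : Poly
      h = (θ ^ₚ k') +ₚ negₚ oneₚ
      coeffh : ∀ i → coeff h i ≡ coeff (θ ^ₚ k') i + - coeff oneₚ i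
      coeffh i = P.trans (coeff-+ (θ ^ₚ k') (negₚ oneₚ) i) (cong (coeff (θ ^ₚ k') i +_) (coeff-neg oneₚ i))
      bnd : DegreeBelow (suc k') h
      bnd zero ()
      bnd (suc i) (s≤s le) = P.trans (coeffh (suc i)) (P.trans (cong₂ (λ a b → a + - b) (coeff-θ^k-≢ k' (suc i) (λ e → NP.<⇒≢ (s≤s le) (P.sym e))) (refl {x = coeff [] i})) (≈⇒≡ (R.trans (R.+-identityˡ _) KF.RP.-0#≈0#)))
      roots : All (λ c → eval h c ≡ 0#) nonzeros
      roots = All.tabulate λ {x} m → let (m' , n) = remove-∈⁻ 0# elems m in
        P.trans (eval-+ (θ ^ₚ k') (negₚ oneₚ) x) (P.trans (cong₂ (λ a b → a + b) (P.trans (eval-^ θ k' x) (P.trans (cong (_^ k') (eval-θ x)) (all x m' n))) (P.trans (eval-neg oneₚ x) (cong -_ (eval-one x)))) (≈⇒≡ (R.-‿inverseʳ 1#)))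
      len : suc k' ≤ length nonzeros
      len = NP.≤-pred (P.subst (suc (suc k') ≤_) (P.sym nonzeros-length) lt)
      h0 : h ≋ []
      h0 = DegreeBelow-roots⇒≋[] (suc k') h bnd nonzeros (remove-Unique 0# elems elems-unique) roots len
      contra : 1# ≡ 0#
      contra = P.trans (≈⇒≡ (R.sym (R.trans (R.+-cong R.refl KF.RP.-0#≈0#) (R.+-identityʳ 1#)))) (P.trans (cong (_+ - 0#) (P.sym (coeff-θ^k k'))) (P.trans (P.sym (coeffh k')) (at h0 k')))
    ... | inj₁ (l , nz , ne) with *≡0⇒ (≈⇒≡ key)
      where
      k' = suc k
      S = KF.Σl elems (λ x → x ^ k')
      eq1 : l ^ k' * S ≈F S
      eq1 = R.trans (KF.Σl-*ˡ elems (l ^ k') (λ x → x ^ k')) (R.trans (KF.Σl-cong elems (λ x → R.sym (^-distrib-* l x k'))) (KF.Σl-reindex elems elems-unique ec (l *_) (inv l nz *_) (inv-cancelˡ l nz) (inv-cancelʳ l nz) (λ x → x ^ k')))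
      key : (l ^ k' + - 1#) * S ≈F 0#
      key = R.trans (R.distribʳ S _ _) (R.trans (R.+-cong eq1 (R.trans (R.sym (KF.RP.-‿distribˡ-* 1# S)) (R.-‿cong (R.*-identityˡ S)))) (R.-‿inverseʳ S))
    ... | inj₁ p = ⊥-elim (ne (≈⇒≡ (KF.RP.x∙y⁻¹≈ε⇒x≈y _ _ (R.reflexive p))))
    ... | inj₂ p = R.reflexive p

    x^q≈x : ∀ c → c ^ q ≈F c
    x^q≈x c with c ≟ 0#
    ... | yes refl = P.subst (λ n → 0# ^ n ≈F 0#) (P.sym (proj₂ q≥2)) (R.zeroˡ _)
    ... | no nz = KF.fermat-by-reindexing _≟_ elems elems-unique ec 0# (λ x → x) (c *_) (inv c nz *_) (inv-cancelˡ c nz) (inv-cancelʳ c nz) (≈⇒≡ (R.zeroʳ c)) c (λ x _ → R.refl) (λ x n → inv x n , R.reflexive (inv-r x n))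

    q≡1+[q∸1] : q ≡ suc (q ∸ 1)
    q≡1+[q∸1] = P.trans (proj₂ q≥2) (cong (λ z → suc (z ∸ 1)) (P.sym (proj₂ q≥2)))

    cancel-nonzero : ∀ {c x y} → ¬ c ≡ 0# → c * x ≈F c * y → x ≈F y
    cancel-nonzero {c} nz = KF.cancelˡ (inv c nz , R.reflexive (inv-r c nz))

    x^[q∸1]≈1 : ∀ c → ¬ c ≡ 0# → c ^ (q ∸ 1) ≈F 1#
    x^[q∸1]≈1 c nz = cancel-nonzero nz (R.trans (R.reflexive (cong (c ^_) (P.sym q≡1+[q∸1]))) (R.trans (x^q≈x c) (R.sym (R.*-identityʳ c))))

    1^k≈1 : ∀ k → 1# ^ k ≈F 1#
    1^k≈1 zero = R.refl
    1^k≈1 (suc k) = R.trans (R.*-identityˡ _) (1^k≈1 k)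

    x^[k*[q∸1]]≈1 : ∀ c → ¬ c ≡ 0# → ∀ k → c ^ (k ℕ.* (q ∸ 1)) ≈F 1#
    x^[k*[q∸1]]≈1 c nz k = R.trans (R.reflexive (cong (c ^_) (NP.*-comm k (q ∸ 1))))
      (R.trans (R.sym (KF.^-assocʳ c (q ∸ 1) k)) (R.trans (KF.^-congˡ k (x^[q∸1]≈1 c nz)) (1^k≈1 k)))

    x^[q^k]≈x : ∀ c k → c ^ (q ℕ.^ k) ≈F c
    x^[q^k]≈x c zero = R.*-identityʳ c
    x^[q^k]≈x c (suc k) = R.trans (R.sym (KF.^-assocʳ c q (q ℕ.^ k))) (R.trans (KF.^-congˡ (q ℕ.^ k) (x^q≈x c)) (x^[q^k]≈x c k))

    x^[q^k∸1]≈1 : ∀ c → ¬ c ≡ 0# → ∀ k → c ^ (q ℕ.^ k ∸ 1) ≈F 1#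
    x^[q^k∸1]≈1 c nz k = cancel-nonzero nz (R.trans (R.reflexive (cong (c ^_) 1+[q^k∸1]≡q^k)) (R.trans (x^[q^k]≈x c k) (R.sym (R.*-identityʳ c))))
      where
      1+[q^k∸1]≡q^k : suc (q ℕ.^ k ∸ 1) ≡ q ℕ.^ k
      1+[q^k∸1]≡q^k = NP.suc-pred (q ℕ.^ k) ⦃ NP.m^n≢0 q k ⦃ P.subst ℕ.NonZero (P.sym (proj₂ q≥2)) _ ⦄ ⦄

    ι : Carrier → Poly
    ι c = c ∷ []

    ι-+ : ∀ x y → (ι x +ₚ ι y) ≋ ι (x + y)
    ι-+ x y = ≋refl

    ι-0 : ι 0# ≋ []
    ι-0 = pw λ { zero → refl ; (suc i) → refl }

    ι-* : ∀ x y → (ι x *ₚ ι y) ≋ ι (x * y)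
    ι-* x y = pw λ { zero → ≈⇒≡ (R.+-identityʳ _) ; (suc i) → refl }

    ι-cong : ∀ {x y} → x ≡ y → ι x ≋ ι y
    ι-cong refl = ≋refl

    ι-pow : ∀ c k → (ι c ^ₚ k) ≋ ι (c ^ k)
    ι-pow c zero = ≋refl
    ι-pow c (suc k) = ≋trans (*ₚ-congʳ (ι c) (ι-pow c k)) (ι-* c (c ^ k))

    ι-Σ : {X : Set} (xs : List X) (g : X → Carrier) → KA.Σl xs (λ x → ι (g x)) ≋ ι (KF.Σl xs g)
    ι-Σ [] g = ≋sym ι-0
    ι-Σ (x ∷ xs) g = ≋trans (+ₚ-cong (≋refl {ι (g x)}) (ι-Σ xs g)) (ι-+ _ _)

    scale-ι : ∀ c f → scale c f ≋ (ι c *ₚ f)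
    scale-ι c f = ≋sym (≋trans (+ₚ-cong (≋refl {scale c f}) (cons-cong {0#} {0#} refl (≋refl {[]}))) (≋trans (+ₚ-comm (scale c f) (0# ∷ [])) (pw λ i → P.trans (coeff-+ (0# ∷ []) (scale c f) i) (P.trans (cong (_+ coeff (scale c f) i) (coeff-[0#] i)) (≈⇒≡ (R.+-identityˡ _))))))

    ^ₚ≡ : ∀ f k → (f ^ₚ k) ≡ (f KA.^ k)
    ^ₚ≡ f zero = refl
    ^ₚ≡ f (suc k) = cong (f *ₚ_) (^ₚ≡ f k)

    powerSum-ι≋[] : ∀ k → suc k < q → KA.Σl elems (λ x → ι x ^ₚ k) ≋ []
    powerSum-ι≋[] k lt = ≋trans (KA.Σl-cong elems (λ x → ι-pow x k)) (≋trans (ι-Σ elems (λ x → x ^ k)) (≋trans (ι-cong (≈⇒≡ (powerSum≈0 k lt))) ι-0))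

    open import Data.Nat.Combinatorics using (_C_; nCk+nC[k+1]≡[n+1]C[k+1]; nCn≡1)
    open import Data.Nat.Combinatorics.Specification using (k>n⇒nCk≡0)
    open import Algebra.Properties.Monoid.Mult R.+-monoid using (×-homo-+) renaming (_×_ to _⊠_)

    binomial : ℕ → Poly
    binomial n = (1# ∷ 1# ∷ []) ^ₚ n

    binomial-step : ∀ f → ((1# ∷ 1# ∷ []) *ₚ f) ≋ (f +ₚ (0# ∷ f))
    binomial-step f = +ₚ-cong (scale-one f) (cons-cong {0#} {0#} refl (*ₚ-idˡ f))

    coeff-binomial : ∀ n i → coeff (binomial n) i ≡ (n C i) ⊠ 1#
    coeff-binomial zero zero = P.sym (≈⇒≡ (R.+-identityʳ 1#))
    coeff-binomial zero (suc i) = refl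
    coeff-binomial (suc n) zero = P.trans (at (binomial-step (binomial n)) zero) (P.trans (coeff-+ (binomial n) (0# ∷ binomial n) zero) (P.trans (≈⇒≡ (R.+-identityʳ _)) (coeff-binomial n zero)))
    coeff-binomial (suc n) (suc i) = P.trans (at (binomial-step (binomial n)) (suc i)) (P.trans (coeff-+ (binomial n) (0# ∷ binomial n) (suc i))
        (P.trans (cong₂ _+_ (coeff-binomial n (suc i)) (coeff-binomial n i)) (P.trans (≈⇒≡ (R.+-comm _ _)) (P.trans (≈⇒≡ (R.sym (×-homo-+ 1# (n C i) (n C suc i)))) (cong (_⊠ 1#) (nCk+nC[k+1]≡[n+1]C[k+1] n i))))))

    eval-1+θ : ∀ c → eval (1# ∷ 1# ∷ []) c ≡ 1# + c
    eval-1+θ c = cong (1# +_) (≈⇒≡ (R.trans (R.*-cong R.refl (R.trans (R.+-cong R.refl (R.zeroʳ c)) (R.+-identityʳ 1#))) (R.*-identityʳ c)))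

    -- (1 + θ)^q - θ^q - 1 has degree < q and, as c^q = c, vanishes on all of F.
    choose-q≈0 : ∀ i → 0 < i → i < q → (q C i) ⊠ 1# ≡ 0#
    choose-q≈0 i lt0 ltq = P.trans (≈⇒≡ (R.sym (R.trans (R.+-cong (R.+-cong R.refl (R.reflexive (P.trans (cong -_ (coeff-θ^k-≢ q i (NP.<⇒≢ ltq))) (≈⇒≡ KF.RP.-0#≈0#)))) (R.reflexive (P.trans (cong -_ (c1 i lt0)) (≈⇒≡ KF.RP.-0#≈0#)))) (R.trans (R.+-identityʳ _) (R.+-identityʳ _)))))
        (P.trans (cong₂ (λ a b → (a + - coeff (θ ^ₚ q) i) + b) (P.sym (coeff-binomial q i)) (P.sym (coeff-neg oneₚ i))) (P.trans (P.sym (coeffh i)) (at h0 i)))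
      where
      h : Poly
      h = (binomial q +ₚ negₚ (θ ^ₚ q)) +ₚ negₚ oneₚ
      c1 : ∀ i → 0 < i → coeff oneₚ i ≡ 0#
      c1 (suc i) _ = refl
      coeffh : ∀ i → coeff h i ≡ (coeff (binomial q) i + - coeff (θ ^ₚ q) i) + coeff (negₚ oneₚ) i
      coeffh i = P.trans (coeff-+ (binomial q +ₚ negₚ (θ ^ₚ q)) (negₚ oneₚ) i) (cong (_+ coeff (negₚ oneₚ) i) (P.trans (coeff-+ (binomial q) (negₚ (θ ^ₚ q)) i) (cong (coeff (binomial q) i +_) (coeff-neg (θ ^ₚ q) i))))
      q≥1 : 0 < q
      q≥1 = P.subst (0 <_) (P.sym (proj₂ q≥2)) (s≤s z≤n)
      bnd : DegreeBelow q h
      bnd i le with NP.m≤n⇒m<n∨m≡n le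
      ... | inj₂ refl = P.trans (coeffh q) (P.trans (cong₂ (λ a b → (a + - b) + coeff (negₚ oneₚ) q) (P.trans (coeff-binomial q q) (cong (_⊠ 1#) (nCn≡1 q))) (coeff-θ^k q))
             (P.trans (cong (((1 ⊠ 1#) + - 1#) +_) (P.trans (coeff-neg oneₚ q) (cong -_ (c1 q q≥1))))
             (≈⇒≡ (R.trans (R.+-cong (R.trans (R.+-cong (R.+-identityʳ 1#) R.refl) (R.-‿inverseʳ 1#)) KF.RP.-0#≈0#) (R.+-identityʳ 0#)))))
      ... | inj₁ lt = P.trans (coeffh i) (P.trans (cong₂ (λ a b → (a + - b) + coeff (negₚ oneₚ) i) (P.trans (coeff-binomial q i) (cong (_⊠ 1#) (k>n⇒nCk≡0 lt))) (coeff-θ^k-≢ q i (λ e → NP.<⇒≢ lt (P.sym e))))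
             (P.trans (cong (((0 ⊠ 1#) + - 0#) +_) (P.trans (coeff-neg oneₚ i) (cong -_ (c1 i (NP.≤-trans (s≤s z≤n) lt)))))
             (≈⇒≡ (R.trans (R.+-cong (R.trans (R.+-identityˡ _) KF.RP.-0#≈0#) KF.RP.-0#≈0#) (R.+-identityʳ 0#)))))
      roots : All (λ c → eval h c ≡ 0#) elems
      roots = All.tabulate λ {c} _ → P.trans (eval-+ (binomial q +ₚ negₚ (θ ^ₚ q)) (negₚ oneₚ) c)
        (P.trans (cong₂ _+_ (P.trans (eval-+ (binomial q) (negₚ (θ ^ₚ q)) c) (cong₂ _+_ (P.trans (eval-^ _ q c) (cong (_^ q) (eval-1+θ c))) (P.trans (eval-neg (θ ^ₚ q) c) (cong -_ (P.trans (eval-^ θ q c) (cong (_^ q) (eval-θ c))))))) (P.trans (eval-neg oneₚ c) (cong -_ (eval-one c))))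
        (≈⇒≡ (R.trans (R.+-cong (R.+-cong (x^q≈x (1# + c)) (R.-‿cong (x^q≈x c))) R.refl) (fin c))))
        where
        fin : ∀ c → ((1# + c) + - c) + - 1# ≈F 0#
        fin c = R.trans (R.+-cong (R.trans (R.+-assoc _ _ _) (R.trans (R.+-cong R.refl (R.-‿inverseʳ c)) (R.+-identityʳ 1#))) R.refl) (R.-‿inverseʳ 1#)
      h0 : h ≋ []
      h0 = DegreeBelow-roots⇒≋[] q h bnd elems elems-unique roots NP.≤-refl

    module BinA = Algebra.Properties.CommutativeSemiring.Binomial (CommutativeRing.commutativeSemiring A)
    module SumA = Algebra.Properties.Semiring.Sum (CommutativeRing.semiring A)
    module MultA = Algebra.Properties.Semiring.Mult (CommutativeRing.semiring A)

    sum-ends : ∀ m (t : Fin (suc (suc m)) → Poly) → (∀ (k : Fin m) → t (Fin.suc (Fin.inject₁ k)) ≋ []) →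
               SumA.sum t ≋ (t Fin.zero +ₚ t (Fin.fromℕ (suc m)))
    sum-ends zero t mid = +ₚ-cong (≋refl {t Fin.zero}) (+ₚ-idʳ (t (Fin.suc Fin.zero)))
    sum-ends (suc m) t mid = ≋trans (+ₚ-cong (≋refl {t Fin.zero}) (sum-ends m (λ k → t (Fin.suc k)) (λ k → mid (Fin.suc k))))
       (+ₚ-cong (≋refl {t Fin.zero}) (≋trans (+ₚ-cong (mid Fin.zero) (≋refl {t (Fin.fromℕ (suc (suc m)))})) (+ₚ-idˡ _)))

    ⊠A-ι : ∀ m → (m MultA.× oneₚ) ≋ ι (m ⊠ 1#)
    ⊠A-ι zero = ≋sym ι-0
    ⊠A-ι (suc m) = ≋trans (+ₚ-cong (≋refl {oneₚ}) (⊠A-ι m)) (ι-+ 1# _)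

    binomial-freshman : ∀ m → (∀ i → 0 < i → i < suc (suc m) → ((suc (suc m)) C i) ⊠ 1# ≡ 0#) → ∀ f g →
              ((f +ₚ g) KA.^ (suc (suc m))) ≋ ((f KA.^ (suc (suc m))) +ₚ (g KA.^ (suc (suc m))))
    binomial-freshman m hyp f g = ≋trans (BinA.theorem n f g) (≋trans (sum-ends (suc m) (BinA.binomialTerm f g n) mid)
         (≋trans (+ₚ-cong first (lastT (Data.Fin.toℕ (Fin.fromℕ n)) (Data.Fin.Properties.toℕ-fromℕ n))) (+ₚ-comm (g KA.^ n) (f KA.^ n))))
      where
      n = suc (suc m)
      first : BinA.binomialTerm f g n Fin.zero ≋ (g KA.^ n)
      first = ≋trans (+ₚ-idʳ _) (*ₚ-idˡ _)
      lastT : ∀ j → j ≡ n → ((n C j) MultA.× ((f KA.^ j) *ₚ (g KA.^ (n ℕ.∸ j)))) ≋ (f KA.^ n)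
      lastT j refl = ≋trans (MultA.×-congˡ {(f KA.^ n) *ₚ (g KA.^ (n ℕ.∸ n))} (nCn≡1 n)) (≋trans (+ₚ-idʳ _)
                       (≋trans (*ₚ-congʳ (f KA.^ n) (≋reflexive (cong (g KA.^_) (NP.n∸n≡0 n)))) (*ₚ-idʳ _)))
        where
        ≋reflexive : ∀ {a b} → a ≡ b → a ≋ b
        ≋reflexive refl = ≋refl
      mid : ∀ (k : Fin (suc m)) → BinA.binomialTerm f g n (Fin.suc (Fin.inject₁ k)) ≋ []
      mid k = ≋trans (≋sym (MultA.×-congʳ c (*ₚ-idˡ _))) (≋trans (≋sym (MultA.×-assoc-* c oneₚ _)) (≋trans (*ₚ-congˡ _ (≋trans (⊠A-ι c) (≋trans (ι-cong zc) ι-0))) ≋refl))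
        where
        i = suc (Data.Fin.toℕ (Fin.inject₁ k))
        c = n C i
        zc : c ⊠ 1# ≡ 0#
        zc = hyp i (s≤s z≤n) (s≤s (P.subst (_< suc m) (P.sym (Data.Fin.Properties.toℕ-inject₁ k)) (Data.Fin.Properties.toℕ<n k)))

    frobenius : ∀ f g → ((f +ₚ g) ^ₚ q) ≋ ((f ^ₚ q) +ₚ (g ^ₚ q))
    frobenius f g with q≥2
    ... | b , eq = P.subst (λ n → ((f +ₚ g) ^ₚ n) ≋ ((f ^ₚ n) +ₚ (g ^ₚ n))) (P.sym eq)
         (P.subst₂ _≋_ (P.sym (^ₚ≡ (f +ₚ g) (suc (suc b)))) (cong₂ _+ₚ_ (P.sym (^ₚ≡ f (suc (suc b)))) (P.sym (^ₚ≡ g (suc (suc b)))))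
           (binomial-freshman b (λ i lt0 lt → P.subst (λ n → (n C i) ⊠ 1# ≡ 0#) eq (choose-q≈0 i lt0 (P.subst (i <_) (P.sym eq) lt))) f g))

    ι^q≋ι : ∀ c → (ι c ^ₚ q) ≋ ι c
    ι^q≋ι c = ≋trans (ι-pow c q) (ι-cong (≈⇒≡ (x^q≈x c)))


module Vanishing where

  open import Data.Nat as ℕ using (ℕ; zero; suc; _≤_; _<_; z≤n; s≤s; _∸_)
  import Data.Nat.Properties as NP
  open import Data.List using (List; []; _∷_; _++_; map; length)
  open import Data.Vec as Vec using (Vec) renaming ([] to []v; _∷_ to _∷v_)
  open import Data.Product using (Σ; _×_; _,_; proj₁; proj₂)
  open import Relation.Nullary using (yes; no)
  open import Relation.Binary.PropositionalEquality as P using (_≡_; refl; cong; cong₂)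
  open import Defs
  open FiniteFields
  import Data.List.Properties
  open import Data.Fin as Fin using (Fin)

  module VanishingOver (F : FiniteField) where
    open FieldLemmas F public
    open R using (Carrier; _+_; _*_; -_)
    open import Algebra.Solver.Ring.NaturalCoefficients.Default KA.commutativeSemiring using (solve; _:=_; _:+_; _:*_)

    AffineForm : ℕ → Set
    AffineForm j = Poly × Vec Poly j

    evalForm : ∀ {j} → AffineForm j → Vec Carrier j → Poly
    evalForm (c , []v) []v = c
    evalForm (c , v ∷v vs) (x ∷v xs) = (v *ₚ ι x) +ₚ evalForm (c , vs) xs

    ΠForms : ∀ {j} → List (AffineForm j) → Vec Carrier j → Poly
    ΠForms fs b = KA.Πl fs (λ f → evalForm f b)

    ΣVec : ∀ j → (Vec Carrier j → Poly) → Poly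
    ΣVec j h = KA.Σl (allVecs j) h

    ΣVec-head : ∀ j h → ΣVec (suc j) h ≋ KA.Σl elems (λ x → ΣVec j (λ b → h (x ∷v b)))
    ΣVec-head j h = ≋trans (KA.Σl-concatMap (λ x → map (x ∷v_) (allVecs j)) elems h)
                       (KA.Σl-cong elems (λ x → KA.reflexive (KA.Σl-map (x ∷v_) (allVecs j) h)))

    ΣVec-cong : ∀ j {h h'} → (∀ b → h b ≋ h' b) → ΣVec j h ≋ ΣVec j h'
    ΣVec-cong j e = KA.Σl-cong (allVecs j) e

    +-suc-middle : ∀ a b k → a ℕ.+ b ℕ.+ suc k ≡ a ℕ.+ suc b ℕ.+ k
    +-suc-middle a b k = P.trans (NP.+-suc (a ℕ.+ b) k) (cong (ℕ._+ k) (P.sym (NP.+-suc a b)))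

    forms-length-drop : ∀ lg k Q J → Q ≤ k → lg ℕ.+ 0 ℕ.+ k < Q ℕ.+ J → lg < J
    forms-length-drop lg k Q J hQk lt = NP.+-cancelˡ-< Q lg J (NP.≤-<-trans (P.subst (_≤ lg ℕ.+ 0 ℕ.+ k) (NP.+-comm lg Q) (P.subst (lg ℕ.+ Q ≤_) (cong (ℕ._+ k) (P.sym (NP.+-identityʳ lg))) (NP.+-monoʳ-≤ lg hQk))) lt)

    -- Expanding the forms in the first coordinate x, a summand
    -- x^k (k < q - 1) dies by the power sums, while for k ≥ q - 1 fewer than (j - 1)(q - 1)
    -- forms remain and induction on j applies.
    mutual
      Σ-ΠForms≋[] : ∀ j (fs : List (AffineForm j)) → length fs < j ℕ.* (q ∸ 1) → ΣVec j (ΠForms fs) ≋ []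
      Σ-ΠForms≋[] zero fs ()
      Σ-ΠForms≋[] (suc j) fs lt = ≋trans (ΣVec-head j (ΠForms fs)) (≋trans (KA.Σl-cong elems (λ x → ΣVec-cong j (λ b → ≋sym (≋trans (*ₚ-idˡ _) (*ₚ-idˡ _)))))
                          (Σ-ΠForms≋[]-aux j [] fs 0 (P.subst (_< suc j ℕ.* (q ∸ 1)) (P.sym (NP.+-identityʳ (length fs))) lt)))

      Σ-ΠForms≋[]-aux : ∀ j (gs : List (AffineForm j)) (fs : List (AffineForm (suc j))) k → length gs ℕ.+ length fs ℕ.+ k < suc j ℕ.* (q ∸ 1) →
          KA.Σl elems (λ x → ΣVec j (λ b → (ι x KA.^ k) *ₚ (ΠForms gs b *ₚ ΠForms fs (x ∷v b)))) ≋ []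
      Σ-ΠForms≋[]-aux j gs [] k lt with suc k ℕ.<? q
      ... | yes lt' = ≋trans (KA.Σl-cong elems (λ x → ≋sym (KA.Σl-*ˡ (allVecs j) (ι x KA.^ k) _)))
                     (≋trans (≋sym (KA.Σl-*ʳ elems _ (λ x → ι x KA.^ k)))
                     (≋trans (*ₚ-congˡ _ (≋trans (KA.Σl-cong elems (λ x → KA.reflexive (P.sym (^ₚ≡ (ι x) k)))) (powerSum-ι≋[] k lt'))) ≋refl))
      ... | no nlt = ≋trans (KA.Σl-cong elems (λ x → ≋trans (ΣVec-cong j (λ b → *ₚ-congʳ (ι x KA.^ k) (*ₚ-idʳ (ΠForms gs b)))) (≋trans (≋sym (KA.Σl-*ˡ (allVecs j) (ι x KA.^ k) (ΠForms gs))) (≋trans (*ₚ-congʳ (ι x KA.^ k) vg) (*ₚ-zeroʳ (ι x KA.^ k))))))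
                     (KA.Σl-0 elems)
        where
        lt2 : length gs < j ℕ.* (q ∸ 1)
        lt2 = forms-length-drop (length gs) k (q ∸ 1) (j ℕ.* (q ∸ 1)) (NP.∸-monoˡ-≤ 1 (NP.≮⇒≥ nlt)) lt
        vg : ΣVec j (ΠForms gs) ≋ []
        vg = Σ-ΠForms≋[] j gs lt2
      Σ-ΠForms≋[]-aux j gs ((c , v ∷v vs) ∷ fs) k lt = ≋trans (KA.Σl-cong elems (λ x → ≋trans (ΣVec-cong j (λ b → expand x b)) (KA.Σl-+ (allVecs j) _ _)))
          (≋trans (KA.Σl-+ elems _ _) (≋trans (+ₚ-cong (≋trans (KA.Σl-cong elems (λ x → ≋sym (KA.Σl-*ˡ (allVecs j) v _))) (≋trans (≋sym (KA.Σl-*ˡ elems v _)) (≋trans (*ₚ-congʳ v (Σ-ΠForms≋[]-aux j gs fs (suc k) lt1)) (*ₚ-zeroʳ v))))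
                                                     (Σ-ΠForms≋[]-aux j ((c , vs) ∷ gs) fs k lt3)) (+ₚ-idˡ [])))
        where
        u : AffineForm j
        u = (c , vs)
        lt1 : length gs ℕ.+ length fs ℕ.+ suc k < suc j ℕ.* (q ∸ 1)
        lt1 = P.subst (_< suc j ℕ.* (q ∸ 1)) (P.sym (+-suc-middle (length gs) (length fs) k)) lt
        lt3 : suc (length gs) ℕ.+ length fs ℕ.+ k < suc j ℕ.* (q ∸ 1)
        lt3 = P.subst (_< suc j ℕ.* (q ∸ 1)) (cong (ℕ._+ k) (NP.+-suc (length gs) (length fs))) lt
        expand : ∀ x b → ((ι x KA.^ k) *ₚ (ΠForms gs b *ₚ ΠForms ((c , v ∷v vs) ∷ fs) (x ∷v b)))
                          ≋ ((v *ₚ ((ι x KA.^ suc k) *ₚ (ΠForms gs b *ₚ ΠForms fs (x ∷v b)))) +ₚ ((ι x KA.^ k) *ₚ (ΠForms (u ∷ gs) b *ₚ ΠForms fs (x ∷v b))))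
        expand x b = solve 6 (λ a ak P Q v U → ak :* (P :* ((v :* a :+ U) :* Q)) := v :* ((a :* ak) :* (P :* Q)) :+ ak :* ((U :* P) :* Q))
                       ≋refl (ι x) (ι x KA.^ k) (ΠForms gs b) (ΠForms fs (x ∷v b)) v (evalForm u b)

    bq : ℕ
    bq = proj₁ q≥2
    Q : ℕ
    Q = suc (suc bq)
    q≡Q : q ≡ Q
    q≡Q = proj₂ q≥2

    open import Algebra.Properties.CommutativeSemiring.Exp KA.commutativeSemiring using (^-distrib-*)
    open import Algebra.Properties.Semiring.Exp KA.semiring using (^-congˡ; ^-homo-*; ^-assocʳ)
    open import Data.Nat.DivMod using (_%_; _/_; m≡m%n+[m/n]*n; m/n<m)

    frobenius-Q : ∀ f g → ((f +ₚ g) KA.^ Q) ≋ ((f KA.^ Q) +ₚ (g KA.^ Q))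
    frobenius-Q f g = P.subst (λ n → ((f +ₚ g) KA.^ n) ≋ ((f KA.^ n) +ₚ (g KA.^ n))) q≡Q
       (P.subst₂ _≋_ (^ₚ≡ (f +ₚ g) q) (cong₂ _+ₚ_ (^ₚ≡ f q) (^ₚ≡ g q)) (frobenius f g))

    ι^Q≋ι : ∀ c → (ι c KA.^ Q) ≋ ι c
    ι^Q≋ι c = P.subst (λ n → (ι c KA.^ n) ≋ ι c) q≡Q (P.subst (_≋ ι c) (^ₚ≡ (ι c) q) (ι^q≋ι c))

    frobeniusForm : ∀ {j} → AffineForm j → AffineForm j
    frobeniusForm (c , v) = (c KA.^ Q , Vec.map (KA._^ Q) v)

    evalForm-frobenius : ∀ {j} (f : AffineForm j) b → evalForm (frobeniusForm f) b ≋ (evalForm f b KA.^ Q)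
    evalForm-frobenius (c , []v) []v = ≋refl
    evalForm-frobenius (c , v ∷v vs) (x ∷v b) = ≋trans (+ₚ-cong (≋trans (*ₚ-congʳ (v KA.^ Q) (≋sym (ι^Q≋ι x))) (≋sym (^-distrib-* v (ι x) Q))) (evalForm-frobenius (c , vs) b))
                                            (≋sym (frobenius-Q (v *ₚ ι x) (evalForm (c , vs) b)))

    ΠForms-replicate : ∀ {j} r (f : AffineForm j) b → ΠForms (Data.List.replicate r f) b ≋ (evalForm f b KA.^ r)
    ΠForms-replicate zero f b = ≋refl
    ΠForms-replicate (suc r) f b = *ₚ-congʳ (evalForm f b) (ΠForms-replicate r f b)

    -- By Frobenius, L^m is the product over the base-q digits m_i of (L^(q^i))^(m_i), and
    -- each L^(q^i) is again affine.
    pow-as-ΠForms : ∀ fuel m {j} (f : AffineForm j) → m ≤ fuel → Σ (List (AffineForm j)) λ fs → (length fs ≡ digitSumAux bq fuel m) × (∀ xs → (evalForm f xs KA.^ m) ≋ ΠForms fs xs)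
    pow-as-ΠForms zero zero f le = [] , refl , λ xs → ≋refl
    pow-as-ΠForms (suc fuel) zero f le = [] , refl , λ xs → ≋refl
    pow-as-ΠForms (suc fuel) (suc m) f (s≤s le) =
        (Data.List.replicate r f ++ fs') , len , evq
      where
      r = suc m % Q
      m' = suc m / Q
      IH = pow-as-ΠForms fuel m' (frobeniusForm f) (NP.≤-trans (NP.≤-pred (m/n<m (suc m) Q (s≤s (s≤s z≤n)))) le)
      fs' = proj₁ IH
      len : length (Data.List.replicate r f ++ fs') ≡ r ℕ.+ digitSumAux bq fuel m'
      len = P.trans (Data.List.Properties.length-++ (Data.List.replicate r f)) (cong₂ ℕ._+_ (Data.List.Properties.length-replicate r) (proj₁ (proj₂ IH)))
      evq : ∀ xs → (evalForm f xs KA.^ suc m) ≋ ΠForms (Data.List.replicate r f ++ fs') xs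
      evq xs = ≋trans (KA.reflexive (cong (x KA.^_) (m≡m%n+[m/n]*n (suc m) Q)))
              (≋trans (^-homo-* x r (m' ℕ.* Q))
              (≋trans (*ₚ-congʳ (x KA.^ r) (≋trans (KA.reflexive (cong (x KA.^_) (NP.*-comm m' Q))) (≋sym (^-assocʳ x Q m'))))
              (≋trans (*ₚ-congˡ ((x KA.^ Q) KA.^ m') (≋sym (ΠForms-replicate r f xs)))
              (≋trans (*ₚ-congʳ (ΠForms (Data.List.replicate r f) xs) (≋trans (^-congˡ m' (≋sym (evalForm-frobenius f xs))) (proj₂ (proj₂ IH) xs)))
                (≋sym (KA.PM.Σl-++ (Data.List.replicate r f) fs' (λ g → evalForm g xs)))))))
        where
        x = evalForm f xs

    zeroForms : ∀ {j} → Vec Poly j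
    zeroForms = Vec.replicate _ []

    evalForm-zeroForms : ∀ {j} c (b : Vec Carrier j) → evalForm (c , zeroForms) b ≋ c
    evalForm-zeroForms c []v = ≋refl
    evalForm-zeroForms c (x ∷v b) = evalForm-zeroForms c b

    monicForm : Poly → (j : ℕ) → AffineForm j
    monicForm base zero = (base , []v)
    monicForm base (suc j) = (θ *ₚ proj₁ (monicForm base j) , oneₚ ∷v Vec.map (θ *ₚ_) (proj₂ (monicForm base j)))

    evalForm-θ : ∀ {j} (c : Poly) (v : Vec Poly j) b → evalForm (θ *ₚ c , Vec.map (θ *ₚ_) v) b ≋ (θ *ₚ evalForm (c , v) b)
    evalForm-θ c []v []v = ≋refl
    evalForm-θ c (w ∷v v) (x ∷v b) = ≋trans (+ₚ-cong (*ₚ-assoc θ w (ι x)) (evalForm-θ c v b)) (≋sym (*ₚ-distribˡ θ (w *ₚ ι x) (evalForm (c , v) b)))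

    evalForm-monic : ∀ base j (b : Vec Carrier j) → evalForm (monicForm base j) b ≋ (Vec.toList b ++ base)
    evalForm-monic base zero []v = ≋refl
    evalForm-monic base (suc j) (x ∷v b) = ≋trans (+ₚ-cong (*ₚ-idˡ (ι x)) (≋trans (evalForm-θ (proj₁ (monicForm base j)) (proj₂ (monicForm base j)) b) (≋trans (*ₚ-congʳ θ (evalForm-monic base j b)) (θ-mul _))))
                                        (cons-cong (≈⇒≡ (R.+-identityʳ x)) ≋refl)

    coeffForm : Poly → ∀ {j} → ℕ → AffineForm j
    coeffForm base {zero} i = (ι (coeff base i) , []v)
    coeffForm base {suc j} zero = ([] , oneₚ ∷v zeroForms)
    coeffForm base {suc j} (suc i) = (proj₁ (coeffForm base {j} i) , [] ∷v proj₂ (coeffForm base {j} i))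

    evalForm-coeffForm : ∀ base {j} i (b : Vec Carrier j) → evalForm (coeffForm base i) b ≋ ι (coeff (Vec.toList b ++ base) i)
    evalForm-coeffForm base {zero} i []v = ≋refl
    evalForm-coeffForm base {suc j} zero (x ∷v b) = ≋trans (+ₚ-cong (*ₚ-idˡ (ι x)) (evalForm-zeroForms [] b)) (+ₚ-idʳ (ι x))
    evalForm-coeffForm base {suc j} (suc i) (x ∷v b) = evalForm-coeffForm base {j} i b

    coeffForms : Poly → ∀ {j} → (s : ℕ) → (Fin s → ℕ) → List (AffineForm j)
    coeffForms base zero m = []
    coeffForms base (suc s) m = coeffForm base (m Fin.zero) ∷ coeffForms base s (λ k → m (Fin.suc k))

    length-coeffForms : ∀ base {j} s m → length (coeffForms base {j} s m) ≡ s
    length-coeffForms base zero m = refl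
    length-coeffForms base (suc s) m = cong suc (length-coeffForms base s (λ k → m (Fin.suc k)))

    tCoeff-as-ΠForms : ∀ base {j} s m (b : Vec Carrier j) → ι (tCoeff s m (Vec.toList b ++ base)) ≋ ΠForms (coeffForms base s m) b
    tCoeff-as-ΠForms base zero m b = ≋refl
    tCoeff-as-ΠForms base (suc s) m b = ≋trans (≋sym (ι-* _ _)) (*ₚ-cong' (≋sym (evalForm-coeffForm base (m Fin.zero) b)) (tCoeff-as-ΠForms base s (λ k → m (Fin.suc k)) b))
      where
      *ₚ-cong' : ∀ {a a' c c'} → a ≋ a' → c ≋ c' → (a *ₚ c) ≋ (a' *ₚ c')
      *ₚ-cong' {a} {a'} {c} {c'} e e' = ≋trans (*ₚ-congˡ c e) (*ₚ-congʳ a' e')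

    Σ-summand≋[] : ∀ base j N s m → s ℕ.+ digitSumAux bq N N < j ℕ.* (q ∸ 1) →
            ΣVec j (λ b → scale (tCoeff s m (Vec.toList b ++ base)) ((Vec.toList b ++ base) ^ₚ N)) ≋ []
    Σ-summand≋[] base j N s m lt = ≋trans (ΣVec-cong j eqn) (Σ-ΠForms≋[] j fs lt')
      where
      pf = pow-as-ΠForms N N (monicForm base j) NP.≤-refl
      cfs = coeffForms base {j} s m
      fs = cfs ++ proj₁ pf
      lt' : length fs < j ℕ.* (q ∸ 1)
      lt' = P.subst (_< j ℕ.* (q ∸ 1)) (P.sym (P.trans (Data.List.Properties.length-++ cfs) (cong₂ ℕ._+_ (length-coeffForms base s m) (proj₁ (proj₂ pf))))) lt
      eqn : ∀ b → scale (tCoeff s m (Vec.toList b ++ base)) ((Vec.toList b ++ base) ^ₚ N) ≋ ΠForms fs b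
      eqn b = ≋trans (scale-ι _ _) (≋trans (*ₚ-congˡ _ (tCoeff-as-ΠForms base s m b))
              (≋trans (*ₚ-congʳ (ΠForms cfs b) (≋trans (KA.reflexive (^ₚ≡ _ N)) (≋trans (^-congˡ N (≋sym (evalForm-monic base j b))) (proj₂ (proj₂ pf) b))))
              (≋sym (KA.PM.Σl-++ cfs (proj₁ pf) (λ g → evalForm g b)))))


module DigitSums where

  open import Data.Nat
  open import Data.Nat.Properties
  open import Data.Nat.DivMod
  open import Relation.Binary.PropositionalEquality
  open import Defs using (digitSumAux)
  open import Algebra.Properties.CommutativeSemigroup +-commutativeSemigroup using (interchange)

  module Base (b : ℕ) where
    Q : ℕ
    Q = suc (suc b)

    digitSum : ℕ → ℕ
    digitSum m = digitSumAux b m m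

    /Q< : ∀ m → suc m / Q < suc m
    /Q< m = m/n<m (suc m) Q (s≤s (s≤s z≤n))

    digitSum-fuel : ∀ f1 f2 m → m ≤ f1 → m ≤ f2 → digitSumAux b f1 m ≡ digitSumAux b f2 m
    digitSum-fuel zero zero zero _ _ = refl
    digitSum-fuel zero (suc f2) zero _ _ = refl
    digitSum-fuel (suc f1) zero zero _ _ = refl
    digitSum-fuel (suc f1) (suc f2) zero _ _ = refl
    digitSum-fuel (suc f1) (suc f2) (suc m) (s≤s l1) (s≤s l2) =
      cong (suc m % Q +_) (digitSum-fuel f1 f2 (suc m / Q) (≤-trans (≤-pred (/Q< m)) l1) (≤-trans (≤-pred (/Q< m)) l2))

    digitSum-step : ∀ r k → r < Q → digitSum (r + k * Q) ≡ r + digitSum k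
    digitSum-step r k lt with r + k * Q in eq
    ... | zero = go r k eq
      where
      kQ0 : ∀ k → k * Q ≡ 0 → k ≡ 0
      kQ0 zero e = refl
      go : ∀ r k → r + k * Q ≡ 0 → 0 ≡ r + digitSum k
      go r k e with m+n≡0⇒m≡0 r e | kQ0 k (m+n≡0⇒n≡0 r e)
      ... | refl | refl = refl
    ... | suc m = trans (cong₂ _+_ e1 (digitSum-fuel m k (suc m / Q) (≤-pred (/Q< m)) (≤-reflexive e2)))
                       (cong (r +_) (cong (λ z → digitSumAux b k z) e2))
      where
      e1 : suc m % Q ≡ r
      e1 = trans (cong (_% Q) (sym eq)) (trans ([m+kn]%n≡m%n r k Q) (m<n⇒m%n≡m lt))
      e2 : suc m / Q ≡ k
      e2 = trans (cong (_/ Q) (sym eq)) (trans (+-distrib-/ r (k * Q) (subst (λ z → r % Q + z < Q) (sym (m*n%n≡0 k Q)) (subst (_< Q) (sym (trans (+-identityʳ _) (m<n⇒m%n≡m lt))) lt)))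
             (trans (cong₂ _+_ (m<n⇒m/n≡0 lt) (m*n/n≡m k Q)) refl))

    1≤Q^k : ∀ k → 1 ≤ Q ^ k
    1≤Q^k zero = s≤s z≤n
    1≤Q^k (suc k) = ≤-trans (1≤Q^k k) (m≤n*m (Q ^ k) Q)

    k<Q^k : ∀ k → k < Q ^ k
    k<Q^k zero = s≤s z≤n
    k<Q^k (suc k) = ≤-trans (+-mono-≤ (1≤Q^k k) (k<Q^k k))
                      (≤-trans (≤-reflexive (cong (Q ^ k +_) (sym (+-identityʳ (Q ^ k))))) (*-mono-≤ {2} {Q} (s≤s (s≤s z≤n)) (≤-refl {Q ^ k})))

    m<Q^k⇒m≤Q^k∸1 : ∀ {m} k → m < Q ^ k → m ≤ Q ^ k ∸ 1
    m<Q^k⇒m≤Q^k∸1 k lt = ≤-pred (subst (_ <_) (sym (trans (+-comm 1 (Q ^ k ∸ 1)) (m∸n+n≡m (1≤Q^k k)))) lt)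

    Q^[1+d]∸1≡ : ∀ d → (Q ∸ 1) + (Q ^ d ∸ 1) * Q ≡ Q ^ suc d ∸ 1
    Q^[1+d]∸1≡ d = begin
      (Q ∸ 1) + (Q ^ d ∸ 1) * Q   ≡⟨ cong (suc b +_) (*-distribʳ-∸ Q (Q ^ d) 1) ⟩
      suc b + (Q ^ d * Q ∸ 1 * Q) ≡⟨ cong₂ (λ x y → suc b + (x ∸ y)) (*-comm (Q ^ d) Q) (*-identityˡ Q) ⟩
      suc b + (Q ^ suc d ∸ Q)     ≡⟨ sym (+-∸-assoc (suc b) Q≤Q^[1+d]) ⟩
      (suc b + Q ^ suc d) ∸ Q     ≡⟨ cong ((suc b + Q ^ suc d) ∸_) (+-comm 1 (suc b)) ⟩
      (suc b + Q ^ suc d) ∸ (suc b + 1) ≡⟨ [m+n]∸[m+o]≡n∸o (suc b) (Q ^ suc d) 1 ⟩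
      Q ^ suc d ∸ 1 ∎
      where
      open ≡-Reasoning
      Q≤Q^[1+d] : Q ≤ Q ^ suc d
      Q≤Q^[1+d] = subst (_≤ Q * Q ^ d) (*-identityʳ Q) (*-monoʳ-≤ Q (1≤Q^k d))

    -- Q^(d+1) - 1 has all digits Q - 1, so subtracting n from it never borrows.
    complement-divmod : ∀ d n → n < Q ^ suc d → Q ^ suc d ∸ 1 ∸ n ≡ (Q ∸ 1 ∸ n % Q) + (Q ^ d ∸ 1 ∸ n / Q) * Q
    complement-divmod d n lt = +-cancelʳ-≡ n _ _ (begin
      (Q ^ suc d ∸ 1 ∸ n) + n                                  ≡⟨ m∸n+n≡m (m<Q^k⇒m≤Q^k∸1 (suc d) lt) ⟩
      Q ^ suc d ∸ 1                                            ≡⟨ sym (Q^[1+d]∸1≡ d) ⟩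
      (Q ∸ 1) + (Q ^ d ∸ 1) * Q                                ≡⟨ cong₂ _+_ (sym (m∸n+n≡m r≤Q∸1)) (cong (_* Q) (sym (m∸n+n≡m n/Q≤))) ⟩
      ((Q ∸ 1 ∸ r) + r) + (X + n / Q) * Q                      ≡⟨ cong (((Q ∸ 1 ∸ r) + r) +_) (*-distribʳ-+ Q X (n / Q)) ⟩
      ((Q ∸ 1 ∸ r) + r) + (X * Q + n / Q * Q)                  ≡⟨ interchange (Q ∸ 1 ∸ r) r (X * Q) (n / Q * Q) ⟩
      ((Q ∸ 1 ∸ r) + X * Q) + (r + n / Q * Q)                  ≡⟨ cong (((Q ∸ 1 ∸ r) + X * Q) +_) (sym (m≡m%n+[m/n]*n n Q)) ⟩
      ((Q ∸ 1 ∸ r) + X * Q) + n ∎)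
      where
      open ≡-Reasoning
      r = n % Q
      X = Q ^ d ∸ 1 ∸ n / Q
      r≤Q∸1 : r ≤ Q ∸ 1
      r≤Q∸1 = ≤-pred (m%n<n n Q)
      n/Q≤ : n / Q ≤ Q ^ d ∸ 1
      n/Q≤ = m<Q^k⇒m≤Q^k∸1 d (m<n*o⇒m/o<n (subst (n <_) (*-comm Q (Q ^ d)) lt))

    digitSum-complement : ∀ d n → n < Q ^ d → digitSum (Q ^ d ∸ 1 ∸ n) + digitSum n ≡ d * (Q ∸ 1)
    digitSum-complement zero zero lt = refl
    digitSum-complement zero (suc n) (s≤s ())
    digitSum-complement (suc d) n lt = begin
      digitSum (Q ^ suc d ∸ 1 ∸ n) + digitSum n                    ≡⟨ cong₂ (λ x y → digitSum x + digitSum y) (complement-divmod d n lt) (m≡m%n+[m/n]*n n Q) ⟩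
      digitSum ((Q ∸ 1 ∸ r) + X * Q) + digitSum (r + n / Q * Q)    ≡⟨ cong₂ _+_ (digitSum-step (Q ∸ 1 ∸ r) X (s≤s (m∸n≤m (suc b) r))) (digitSum-step r (n / Q) (m%n<n n Q)) ⟩
      ((Q ∸ 1 ∸ r) + digitSum X) + (r + digitSum (n / Q))          ≡⟨ interchange (Q ∸ 1 ∸ r) (digitSum X) r (digitSum (n / Q)) ⟩
      ((Q ∸ 1 ∸ r) + r) + (digitSum X + digitSum (n / Q))          ≡⟨ cong₂ _+_ (m∸n+n≡m (≤-pred (m%n<n n Q))) (digitSum-complement d (n / Q) n/Q<) ⟩
      (Q ∸ 1) + d * (Q ∸ 1) ∎
      where
      open ≡-Reasoning
      r = n % Q
      X = Q ^ d ∸ 1 ∸ n / Q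
      n/Q< : n / Q < Q ^ d
      n/Q< = m<n*o⇒m/o<n (subst (n <_) (*-comm Q (Q ^ d)) lt)


module VectorSums where

  open import Data.Nat as ℕ using (ℕ; zero; suc)
  open import Data.List using (List; []; _∷_; _++_; map; length; [_]; concatMap)
  import Data.List.Properties as LP
  open import Data.Vec as Vec using (Vec) renaming ([] to []v; _∷_ to _∷v_)
  import Data.Vec.Properties as VP
  open import Data.List.Relation.Unary.Any using (here; there)
  open import Data.List.Relation.Unary.All using ([]; _∷_)
  open import Data.List.Relation.Unary.AllPairs using ([]; _∷_)
  open import Data.List.Membership.Propositional using (_∈_)
  open import Data.List.Membership.Propositional.Properties using (∈-map⁺; ∈-map⁻; ∈-++⁺ˡ; ∈-++⁺ʳ; ∈-++⁻)
  open import Data.List.Relation.Unary.Unique.Propositional using (Unique)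
  import Data.List.Relation.Unary.Unique.Propositional.Properties as UP
  open import Data.Product using (_,_)
  open import Data.Sum using (inj₁; inj₂)
  open import Relation.Nullary using (¬_; Dec)
  open import Relation.Binary.PropositionalEquality as P using (_≡_; refl; cong₂)
  open import Defs
  open ListSums
  open Vanishing

  module VectorSumsOver (F : FiniteField) where
    open VanishingOver F public
    open R using (Carrier; _*_; 0#; 1#)

    allVecs-complete : ∀ j (v : Vec Carrier j) → v ∈ allVecs j
    allVecs-complete zero []v = here refl
    allVecs-complete (suc j) (x ∷v v) = go elems (ec x)
      where
      go : ∀ xs → x ∈ xs → (x ∷v v) ∈ concatMap (λ y → map (y ∷v_) (allVecs j)) xs
      go (y ∷ ys) (here refl) = ∈-++⁺ˡ (∈-map⁺ (x ∷v_) (allVecs-complete j v))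
      go (y ∷ ys) (there m) = ∈-++⁺ʳ (map (y ∷v_) (allVecs j)) (go ys m)

    allVecs-unique : ∀ j → Unique (allVecs j)
    allVecs-unique zero = [] ∷ []
    allVecs-unique (suc j) = go elems elems-unique
      where
      hd : ∀ {y} ys {w : Vec Carrier (suc j)} → w ∈ concatMap (λ y → map (y ∷v_) (allVecs j)) ys → Vec.head w ∈ ys
      hd (y ∷ ys) m with ∈-++⁻ (map (y ∷v_) (allVecs j)) m
      ... | inj₁ m' with ∈-map⁻ (y ∷v_) m'
      ...   | _ , _ , refl = here refl
      hd (y ∷ ys) m | inj₂ m' = there (hd {y} ys m')
      go : ∀ xs → Unique xs → Unique (concatMap (λ y → map (y ∷v_) (allVecs j)) xs)
      go [] u = []
      go (y ∷ ys) u = UP.++⁺ (UP.map⁺ (λ e → VP.∷-injectiveʳ e) (allVecs-unique j)) (go ys (Unique-tail u))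
        (λ { (m1 , m2) → Unique-head u (P.subst (_∈ ys) (head1 m1) (hd {y} ys m2)) })
        where
        head1 : ∀ {w} → w ∈ map (y ∷v_) (allVecs j) → Vec.head w ≡ y
        head1 m with ∈-map⁻ (y ∷v_) m
        ... | _ , _ , refl = refl

    allVecs-length : ∀ j → length (allVecs j) ≡ q ℕ.^ j
    allVecs-length zero = refl
    allVecs-length (suc j) = go elems
      where
      go : ∀ xs → length (concatMap (λ y → map (y ∷v_) (allVecs j)) xs) ≡ length xs ℕ.* q ℕ.^ j
      go [] = refl
      go (y ∷ ys) = P.trans (LP.length-++ (map (y ∷v_) (allVecs j))) (cong₂ ℕ._+_ (P.trans (LP.length-map (y ∷v_) (allVecs j)) (allVecs-length j)) (go ys))

    _≟v_ : ∀ {j} (v w : Vec Carrier j) → Dec (v ≡ w)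
    _≟v_ = VP.≡-dec _≟_

    ++[0#]≋ : ∀ l → (l ++ [ 0# ]) ≋ l
    ++[0#]≋ [] = pw λ { zero → refl ; (suc i) → refl }
    ++[0#]≋ (x ∷ l) = cons-cong refl (++[0#]≋ l)

    ++-scale-last : ∀ {j} (u : Vec Carrier j) c (nz : ¬ c ≡ 0#) → (Vec.toList u ++ [ c ]) ≋ scale c (Vec.toList (Vec.map (inv c nz *_) u) ++ [ 1# ])
    ++-scale-last []v c nz = cons-cong (P.sym (≈⇒≡ (R.*-identityʳ c))) ≋refl
    ++-scale-last (x ∷v u) c nz = cons-cong (P.sym (inv-cancelʳ c nz x)) (++-scale-last u c nz)

    ΣVec-last : ∀ j (h : Vec Carrier (suc j) → Poly) → ΣVec (suc j) h ≋ KA.Σl elems (λ c → ΣVec j (λ b → h (b Vec.∷ʳ c)))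
    ΣVec-last zero h = ≋trans (ΣVec-head zero h) (KA.Σl-cong elems (λ c → ≋refl))
    ΣVec-last (suc j) h = ≋trans (ΣVec-head (suc j) h) (≋trans (KA.Σl-cong elems (λ x → ΣVec-last j (λ b → h (x ∷v b))))
                         (≋trans (KA.Σl-swap elems elems (λ x c → ΣVec j (λ b → h (x ∷v (b Vec.∷ʳ c)))))
                           (KA.Σl-cong elems (λ c → ≋sym (ΣVec-head j (λ b → h (b Vec.∷ʳ c)))))))

    ΣVec-scale : ∀ j (l : Carrier) (nz : ¬ l ≡ 0#) (h : Vec Carrier j → Poly) → ΣVec j (λ b → h (Vec.map (l *_) b)) ≋ ΣVec j h
    ΣVec-scale j l nz h = KA.Σl-reindex (allVecs j) (allVecs-unique j) (allVecs-complete j) (Vec.map (l *_)) (Vec.map (inv l nz *_)) st ts h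
      where
      st : ∀ v → Vec.map (inv l nz *_) (Vec.map (l *_) v) ≡ v
      st v = P.trans (P.sym (VP.map-∘ (inv l nz *_) (l *_) v)) (P.trans (VP.map-cong (inv-cancelˡ l nz) v) (VP.map-id v))
      ts : ∀ v → Vec.map (l *_) (Vec.map (inv l nz *_) v) ≡ v
      ts v = P.trans (P.sym (VP.map-∘ (l *_) (inv l nz *_) v)) (P.trans (VP.map-cong (inv-cancelʳ l nz) v) (VP.map-id v))


module BGRecurrence where

  open import Data.Nat as ℕ using (ℕ; zero; suc; _<_; _∸_)
  open import Data.Fin as Fin using (Fin)
  open import Data.List using (List; []; _∷_; _++_; map; [_])
  import Data.List.Properties as LP
  open import Data.Vec as Vec using (Vec) renaming ([] to []v; _∷_ to _∷v_)
  open import Relation.Nullary using (¬_; yes; no)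
  open import Relation.Binary.PropositionalEquality as P using (_≡_; refl; cong; cong₂)
  open import Defs
  open VectorSums
  import Algebra.Solver.Ring.NaturalCoefficients.Default

  module RecurrenceOver (F : FiniteField) (N s : ℕ) (m : Fin s → ℕ) where
    open VectorSumsOver F public
    open R using (Carrier; _+_; _*_; 0#; 1#) renaming (_≈_ to _≈F_)
    open KF using (_^_)
    open import Algebra.Properties.Semiring.Exp R.semiring using () renaming (^-homo-* to ^-homo-*F)
    open import Algebra.Solver.Ring.NaturalCoefficients.Default R.commutativeSemiring using (solve; _:=_; _:+_; _:*_)
    open import Algebra.Properties.CommutativeSemiring.Exp KA.commutativeSemiring using (^-distrib-*)
    module SA = Algebra.Solver.Ring.NaturalCoefficients.Default KA.commutativeSemiring

    summand : Poly → Poly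
    summand p = scale (tCoeff s m p) (p ^ₚ N)

    tCoeff-cong : ∀ s (m : Fin s → ℕ) {p p'} → p ≋ p' → tCoeff s m p ≡ tCoeff s m p'
    tCoeff-cong zero m e = refl
    tCoeff-cong (suc s) m e = cong₂ _*_ (at e (m Fin.zero)) (tCoeff-cong s (λ k → m (Fin.suc k)) e)

    summand-cong : ∀ {p p'} → p ≋ p' → summand p ≋ summand p'
    summand-cong {p} {p'} e = ≋trans (scale-congˡ (p ^ₚ N) (tCoeff-cong s m e)) (scale-congʳ _ (≋trans (KA.reflexive (^ₚ≡ _ N)) (≋trans (KA.^-congˡ N e) (KA.reflexive (P.sym (^ₚ≡ _ N))))))

    tCoeff-scale : ∀ s (m : Fin s → ℕ) c p → tCoeff s m (scale c p) ≈F (c ^ s) * tCoeff s m p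
    tCoeff-scale zero m c p = R.sym (R.*-identityˡ 1#)
    tCoeff-scale (suc s) m c p = R.trans (R.*-cong (R.reflexive (coeff-scale c p (m Fin.zero))) (tCoeff-scale s (λ k → m (Fin.suc k)) c p))
       (solve 4 (λ c a cs t → (c :* a) :* (cs :* t) := (c :* cs) :* (a :* t)) R.refl c (coeff p (m Fin.zero)) (c ^ s) (tCoeff s (λ k → m (Fin.suc k)) p))

    summand-scale : ∀ c p → summand (scale c p) ≋ (ι (c ^ (s ℕ.+ N)) *ₚ summand p)
    summand-scale c p = begin
        summand (scale c p) ≈⟨ scale-ι _ _ ⟩
        ι (tCoeff s m (scale c p)) *ₚ (scale c p ^ₚ N) ≈⟨ *ₚ-congˡ (scale c p ^ₚ N) (ι-cong (≈⇒≡ (tCoeff-scale s m c p))) ⟩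
        ι (c ^ s * t) *ₚ (scale c p ^ₚ N) ≈⟨ *ₚ-congʳ (ι (c ^ s * t)) (KA.reflexive (^ₚ≡ (scale c p) N)) ⟩
        ι (c ^ s * t) *ₚ (scale c p KA.^ N) ≈⟨ *ₚ-congʳ (ι (c ^ s * t)) (KA.^-congˡ N (scale-ι c p)) ⟩
        ι (c ^ s * t) *ₚ ((ι c *ₚ p) KA.^ N) ≈⟨ *ₚ-congʳ (ι (c ^ s * t)) (^-distrib-* (ι c) p N) ⟩
        ι (c ^ s * t) *ₚ ((ι c KA.^ N) *ₚ (p KA.^ N)) ≈⟨ KA.*-cong (≋sym (ι-* _ _)) (*ₚ-congˡ (p KA.^ N) (≋trans (KA.reflexive (P.sym (^ₚ≡ (ι c) N))) (ι-pow c N))) ⟩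
        (ι (c ^ s) *ₚ ι t) *ₚ (ι (c ^ N) *ₚ (p KA.^ N)) ≈⟨ SA.solve 4 (λ a b e f → (a SA.:* b) SA.:* (e SA.:* f) SA.:= (a SA.:* e) SA.:* (b SA.:* f)) ≋refl (ι (c ^ s)) (ι t) (ι (c ^ N)) (p KA.^ N) ⟩
        (ι (c ^ s) *ₚ ι (c ^ N)) *ₚ (ι t *ₚ (p KA.^ N)) ≈⟨ KA.*-cong (≋trans (ι-* _ _) (ι-cong (≈⇒≡ (R.sym (^-homo-*F c s N))))) (≋trans (*ₚ-congʳ (ι t) (KA.reflexive (P.sym (^ₚ≡ p N)))) (≋sym (scale-ι t (p ^ₚ N)))) ⟩
        ι (c ^ (s ℕ.+ N)) *ₚ summand p ∎
      where
      t = tCoeff s m p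
      open import Relation.Binary.Reasoning.Setoid KA.setoid

    bg : ℕ → Poly
    bg j = BGterm N s j m

    sumₚ-map : {X : Set} (g : X → Poly) (xs : List X) → sumₚ (map g xs) ≡ KA.Σl xs g
    sumₚ-map g [] = refl
    sumₚ-map g (x ∷ xs) = cong (g x +ₚ_) (sumₚ-map g xs)

    BGterm-as-ΣVec : ∀ j → bg j ≡ ΣVec j (λ b → summand (Vec.toList b ++ [ 1# ]))
    BGterm-as-ΣVec j = P.trans (sumₚ-map summand (monics j)) (KA.Σl-map monic (allVecs j) summand)

    partial : ℕ → Poly
    partial j = ΣVec j (λ b → summand (Vec.toList b ++ []))

    toList-∷ʳ : ∀ {j} (b : Vec Carrier j) c → Vec.toList (b Vec.∷ʳ c) ≡ Vec.toList b ++ [ c ]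
    toList-∷ʳ []v c = refl
    toList-∷ʳ (x ∷v b) c = cong (x ∷_) (toList-∷ʳ b c)

    Σ-const≋[] : ∀ (t : Poly) → KA.Σl elems (λ _ → t) ≋ []
    Σ-const≋[] t = ≋trans (KA.Σl-cong elems (λ _ → ≋sym (*ₚ-idˡ t))) (≋trans (≋sym (KA.Σl-*ʳ elems t (λ _ → oneₚ)))
                (≋trans (*ₚ-congˡ t (≋trans (ι-Σ elems (λ _ → 1#)) (≋trans (ι-cong (≈⇒≡ Σ-1≈0)) ι-0))) ≋refl))

    -- The sum of a^N a(t_1)⋯a(t_s) over all a of degree < j + 1 is the one over degree < j plus
    -- Σ_{c ≠ 0} c^(s+N) times the BG term of degree j, i.e. minus that term, since q ≡ 0.
    module Homogeneous (hyp : ∀ c → ¬ c ≡ 0# → c ^ (s ℕ.+ N) ≈F 1#) where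
      ΣVec-lastCoeff : ∀ j c → ΣVec j (λ b → summand (Vec.toList b ++ [ c ])) ≋ KA.choose (c ≟ 0#) (partial j) (bg j)
      ΣVec-lastCoeff j c with c ≟ 0#
      ... | yes refl = ΣVec-cong j (λ b → summand-cong (≋trans (++[0#]≋ (Vec.toList b)) (KA.reflexive (P.sym (LP.++-identityʳ (Vec.toList b))))))
      ... | no nz = ≋trans (ΣVec-cong j (λ b → ≋trans (summand-cong (++-scale-last b c nz)) (≋trans (summand-scale c _) (≋trans (*ₚ-congˡ _ (ι-cong (≈⇒≡ (hyp c nz)))) (*ₚ-idˡ _)))))
                      (≋trans (ΣVec-scale j (inv c nz) (inv-nonzero c nz) (λ b → summand (Vec.toList b ++ [ 1# ]))) (KA.reflexive (P.sym (BGterm-as-ΣVec j))))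

      partial-step : ∀ j → (partial (suc j) +ₚ bg j) ≋ partial j
      partial-step j = ≋trans (+ₚ-cong (≋trans (ΣVec-last j (λ b → summand (Vec.toList b ++ []))) (KA.Σl-cong elems (λ c → ≋trans (ΣVec-cong j (λ b → KA.reflexive (cong (λ l → summand (l ++ [])) (toList-∷ʳ b c)))) (≋trans (ΣVec-cong j (λ b → summand-cong (KA.reflexive (LP.++-assoc (Vec.toList b) [ c ] [])))) (ΣVec-lastCoeff j c)))))
                               (≋refl {bg j}))
              (≋trans (KA.Σl-choose-once _≟_ 0# (partial j) (bg j) elems elems-unique (ec 0#)) (≋trans (+ₚ-cong (≋refl {partial j}) (Σ-const≋[] (bg j))) (+ₚ-idʳ (partial j))))

      partial-telescope : ∀ N' → N ≡ suc N' → ∀ j → (partial j +ₚ sumBelow j bg) ≋ []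
      partial-telescope N' refl zero = ≋refl
      partial-telescope N' refl (suc j) = ≋trans (SA.solve 3 (λ a b c → a SA.:+ (b SA.:+ c) SA.:= (a SA.:+ c) SA.:+ b) ≋refl (partial (suc j)) (sumBelow j bg) (bg j))
                               (≋trans (+ₚ-cong (partial-step j) (≋refl {sumBelow j bg})) (partial-telescope N' refl j))

      ΣBGterm≋[] : ∀ N' → N ≡ suc N' → ∀ d → s ℕ.+ digitSumAux bq N N < d ℕ.* (q ∸ 1) → sumBelow d bg ≋ []
      ΣBGterm≋[] N' eq d lt = ≋trans (≋sym (+ₚ-idˡ (sumBelow d bg))) (≋trans (+ₚ-cong (≋sym (Σ-summand≋[] [] d N s m lt)) (≋refl {sumBelow d bg})) (partial-telescope N' eq d))


module Residues where

  open import Data.Nat as ℕ using (ℕ; zero; suc; _≤_; _<_; s≤s; _∸_)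
  import Data.Nat.Properties as NP
  open import Data.List using (List; []; _∷_; _++_; map; length; [_])
  open import Data.Vec as Vec using (Vec) renaming ([] to []v; _∷_ to _∷v_)
  open import Data.Product using (_,_; proj₁; proj₂)
  open import Data.Empty using (⊥-elim)
  open import Relation.Nullary using (¬_; yes; no)
  open import Relation.Binary.PropositionalEquality as P using (_≡_; refl; cong; cong₂)
  open import Defs
  open CommutativeRings
  open VectorSums
  open DigitSums using (module Base)
  open import Algebra.Bundles using (CommutativeRing)

  module ModuloMonic (F : FiniteField) (d' : ℕ) (cs : Vec (CommutativeRing.Carrier (FiniteField.ring F)) (suc d')) where
    open VectorSumsOver F public
    open R using (Carrier; _+_; _*_; -_; 0#; 1#)

    d : ℕ
    d = suc d'

    P₀ : Poly
    P₀ = monic cs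

    module Mod = KA.ModIdeal P₀
    module KQ = RingLemmas Mod.quotientRing
    open Mod using (_~_; ≈⇒~; ~refl; ~sym; ~trans; ~+; ~*)

    CongMod⇒~ : ∀ {f g} → CongMod P₀ f g → f ~ g
    CongMod⇒~ {f} {g} (h , e) = h , ≋trans (≋sym (≋trans (KA.+-assoc f (negₚ g) g) (≋trans (+ₚ-cong (≋refl {f}) (KA.-‿inverseˡ g)) (+ₚ-idʳ f))))
                                     (≋trans (+ₚ-cong (pw e) (≋refl {g})) (+ₚ-comm (h *ₚ P₀) g))

    ~⇒CongMod : ∀ {f g} → f ~ g → CongMod P₀ f g
    ~⇒CongMod {f} {g} (h , e) = h , at (≋trans (+ₚ-cong e (≋refl {negₚ g})) (≋trans (+ₚ-cong (+ₚ-comm g (h *ₚ P₀)) (≋refl {negₚ g}))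
                                     (≋trans (KA.+-assoc (h *ₚ P₀) g (negₚ g)) (≋trans (+ₚ-cong (≋refl {h *ₚ P₀}) (KA.-‿inverseʳ g)) (+ₚ-idʳ _)))))

    scale-~ : ∀ c {x y} → x ~ y → scale c x ~ scale c y
    scale-~ c {x} {y} e = ~trans (≈⇒~ (scale-ι c x)) (~trans (~* (~refl {ι c}) e) (≈⇒~ (≋sym (scale-ι c y))))

    sumₚ-map-mod : {X : Set} (g : X → Poly) (xs : List X) → sumₚ (map g xs) ≡ KQ.Σl xs g
    sumₚ-map-mod g [] = refl
    sumₚ-map-mod g (x ∷ xs) = cong (g x +ₚ_) (sumₚ-map-mod g xs)

    toList-DegreeBelow : ∀ {n} (v : Vec Carrier n) i → n ≤ i → coeff (Vec.toList v) i ≡ 0#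
    toList-DegreeBelow []v i le = refl
    toList-DegreeBelow (x ∷v v) (suc i) (s≤s le) = toList-DegreeBelow v i le

    coeff-monic-top : ∀ {n} (u : Vec Carrier n) → coeff (Vec.toList u ++ [ 1# ]) n ≡ 1#
    coeff-monic-top []v = refl
    coeff-monic-top (x ∷v u) = coeff-monic-top u

    coeff-monic-above : ∀ {n} (u : Vec Carrier n) i → n < i → coeff (Vec.toList u ++ [ 1# ]) i ≡ 0#
    coeff-monic-above []v (suc i) lt = refl
    coeff-monic-above (x ∷v u) (suc i) (s≤s lt) = coeff-monic-above u i lt

    DegreeBelow-*P₀⇒≋[] : ∀ h → DegreeBelow d (h *ₚ P₀) → h ≋ []
    DegreeBelow-*P₀⇒≋[] [] b = ≋refl
    DegreeBelow-*P₀⇒≋[] (x ∷ h') b = pw λ { zero → x≡0# ; (suc i) → at h'≋[] i }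
      where
      coeff-suc : ∀ i → coeff ((x ∷ h') *ₚ P₀) (suc i) ≡ x * coeff P₀ (suc i) + coeff (h' *ₚ P₀) i
      coeff-suc i = P.trans (coeff-+ (scale x P₀) (0# ∷ (h' *ₚ P₀)) (suc i)) (cong (_+ coeff (h' *ₚ P₀) i) (coeff-scale x P₀ (suc i)))
      h'-DegreeBelow : DegreeBelow d (h' *ₚ P₀)
      h'-DegreeBelow i le = P.trans (P.sym (≈⇒≡ (R.trans (R.+-cong (R.trans (R.*-cong R.refl (R.reflexive (coeff-monic-above cs (suc i) (s≤s le)))) (R.zeroʳ x)) R.refl) (R.+-identityˡ _))))
                   (P.trans (P.sym (coeff-suc i)) (b (suc i) (NP.≤-trans le (NP.n≤1+n i))))
      h'≋[] : h' ≋ []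
      h'≋[] = DegreeBelow-*P₀⇒≋[] h' h'-DegreeBelow
      x≡0# : x ≡ 0#
      x≡0# = P.trans (≈⇒≡ (R.sym (R.trans (R.+-cong (R.trans (R.*-cong R.refl (R.reflexive (coeff-monic-top cs))) (R.*-identityʳ x)) (R.reflexive (at (*ₚ-zeroˡ h' P₀ h'≋[]) d'))) (R.+-identityʳ x))))
             (P.trans (P.sym (coeff-suc d')) (b d NP.≤-refl))

    toList-injective : ∀ {n} (v w : Vec Carrier n) → Vec.toList v ≋ Vec.toList w → v ≡ w
    toList-injective []v []v e = refl
    toList-injective (x ∷v v) (y ∷v w) e = cong₂ _∷v_ (at e zero) (toList-injective v w (tail≋ e))

    residue-unique : ∀ (v w : Vec Carrier d) → Vec.toList v ~ Vec.toList w → v ≡ w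
    residue-unique v w (h , e) = toList-injective v w (≋trans e (≋trans (+ₚ-cong (≋refl {Vec.toList w}) (*ₚ-congˡ P₀ h≋[])) (+ₚ-idʳ _)))
      where
      hP₀-DegreeBelow : DegreeBelow d (h *ₚ P₀)
      hP₀-DegreeBelow i le = P.trans (P.sym (≈⇒≡ (R.+-identityˡ _))) (P.trans (cong (_+ coeff (h *ₚ P₀) i) (P.sym (toList-DegreeBelow w i le)))
                   (P.trans (P.sym (coeff-+ (Vec.toList w) (h *ₚ P₀) i)) (P.trans (P.sym (at e i)) (toList-DegreeBelow v i le))))
      h≋[] : h ≋ []
      h≋[] = DegreeBelow-*P₀⇒≋[] h hP₀-DegreeBelow

    lastElem : ∀ {n} → Vec Carrier (suc n) → Carrier
    lastElem (a ∷v []v) = a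
    lastElem (a ∷v b ∷v v) = lastElem (b ∷v v)

    shiftIn : ∀ {n} → Carrier → Vec Carrier (suc n) → Vec Carrier (suc n)
    shiftIn x (a ∷v []v) = x ∷v []v
    shiftIn x (a ∷v b ∷v v) = x ∷v shiftIn a (b ∷v v)

    ∷-as-shiftIn++last : ∀ {n} x (v : Vec Carrier (suc n)) → (x ∷ Vec.toList v) ≡ Vec.toList (shiftIn x v) ++ [ lastElem v ]
    ∷-as-shiftIn++last x (a ∷v []v) = refl
    ∷-as-shiftIn++last x (a ∷v b ∷v v) = cong (x ∷_) (∷-as-shiftIn++last a (b ∷v v))

    initElems : ∀ {n} → Vec Carrier (suc n) → Vec Carrier n
    initElems (a ∷v []v) = []v
    initElems (a ∷v b ∷v v) = a ∷v initElems (b ∷v v)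

    init-++-last : ∀ {n} (v : Vec Carrier (suc n)) → Vec.toList v ≡ Vec.toList (initElems v) ++ [ lastElem v ]
    init-++-last (a ∷v []v) = refl
    init-++-last (a ∷v b ∷v v) = cong (a ∷_) (init-++-last (b ∷v v))

    -- Horner's scheme modulo the monic P₀: shift in the next coefficient, then cancel the
    -- coefficient that overflowed into degree d by subtracting that multiple of P₀.
    reduce : Poly → Vec Carrier d
    reduce [] = Vec.replicate d 0#
    reduce (x ∷ f) = Vec.zipWith (λ a c → a + - (lastElem (reduce f) * c)) (shiftIn x (reduce f)) cs

    zeros-≋[] : ∀ n → Vec.toList (Vec.replicate n 0#) ≋ []
    zeros-≋[] zero = ≋refl
    zeros-≋[] (suc n) = pw λ { zero → refl ; (suc i) → at (zeros-≋[] n) i }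

    ++-as-+ₚ-zeros : ∀ {n} (u : Vec Carrier n) w → (Vec.toList u ++ w) ≋ (Vec.toList u +ₚ (Vec.toList (Vec.replicate n 0#) ++ w))
    ++-as-+ₚ-zeros []v w = ≋refl
    ++-as-+ₚ-zeros (x ∷v u) w = cons-cong (P.sym (≈⇒≡ (R.+-identityʳ x))) (++-as-+ₚ-zeros u w)

    scale-zeros++[1#] : ∀ n t → scale t (Vec.toList (Vec.replicate n 0#) ++ [ 1# ]) ≋ (Vec.toList (Vec.replicate n 0#) ++ [ t ])
    scale-zeros++[1#] zero t = cons-cong (≈⇒≡ (R.*-identityʳ t)) ≋refl
    scale-zeros++[1#] (suc n) t = cons-cong (≈⇒≡ (R.zeroʳ t)) (scale-zeros++[1#] n t)

    toList-zipWith-sub : ∀ {n} (u w : Vec Carrier n) t → Vec.toList (Vec.zipWith (λ a c → a + - (t * c)) u w) ≋ (Vec.toList u +ₚ negₚ (scale t (Vec.toList w)))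
    toList-zipWith-sub []v []v t = ≋refl
    toList-zipWith-sub (a ∷v u) (c ∷v w) t = cons-cong refl (toList-zipWith-sub u w t)

    -+-cancel-middle : ∀ a b e → ((a +ₚ negₚ b) +ₚ (b +ₚ e)) ≋ (a +ₚ e)
    -+-cancel-middle a b e = ≋trans (KA.+-assoc a (negₚ b) (b +ₚ e)) (+ₚ-cong (≋refl {a}) (≋trans (≋sym (KA.+-assoc (negₚ b) b e)) (≋trans (+ₚ-cong (KA.-‿inverseˡ b) (≋refl {e})) (+ₚ-idˡ e))))

    ∷-as-ι+θ* : ∀ x g → (x ∷ g) ≋ (ι x +ₚ (θ *ₚ g))
    ∷-as-ι+θ* x g = ≋sym (≋trans (+ₚ-cong (≋refl {ι x}) (θ-mul g)) (cons-cong (≈⇒≡ (R.+-identityʳ x)) ≋refl))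

    reduce-~ : ∀ f → Vec.toList (reduce f) ~ f
    reduce-~ [] = ≈⇒~ (zeros-≋[] d)
    reduce-~ (x ∷ f) = ~trans (~sym reduce-step) ∷-cong-~
      where
      v = reduce f
      t = lastElem v
      u = shiftIn x v
      Z = Vec.toList (Vec.replicate d 0#)
      eP : scale t P₀ ≋ (scale t (Vec.toList cs) +ₚ (Z ++ [ t ]))
      eP = ≋trans (scale-congʳ t (++-as-+ₚ-zeros cs [ 1# ])) (≋trans (scale-+ t (Vec.toList cs) (Z ++ [ 1# ])) (+ₚ-cong (≋refl {scale t (Vec.toList cs)}) (scale-zeros++[1#] d t)))
      reduce-step : (x ∷ Vec.toList v) ~ Vec.toList (reduce (x ∷ f))
      reduce-step = ι t , ≋trans (KA.reflexive (∷-as-shiftIn++last x v)) (≋trans (++-as-+ₚ-zeros u [ t ])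
               (≋sym (≋trans (+ₚ-cong (toList-zipWith-sub u cs t) (≋sym (scale-ι t P₀))) (≋trans (+ₚ-cong (≋refl {Vec.toList u +ₚ negₚ (scale t (Vec.toList cs))}) eP) (-+-cancel-middle (Vec.toList u) (scale t (Vec.toList cs)) (Z ++ [ t ]))))))
      ∷-cong-~ : (x ∷ Vec.toList v) ~ (x ∷ f)
      ∷-cong-~ = ~trans (≈⇒~ (∷-as-ι+θ* x (Vec.toList v))) (~trans (~+ (~refl {ι x}) (~* (~refl {θ}) (reduce-~ f))) (≈⇒~ (≋sym (∷-as-ι+θ* x f))))

    zeros : Vec Carrier d
    zeros = Vec.replicate d 0#

    module MultiplicationBy (a a' : Poly) (aa' : (a *ₚ a') ~ oneₚ) where
      σ : Vec Carrier d → Vec Carrier d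
      σ v = reduce (a *ₚ Vec.toList v)
      τ : Vec Carrier d → Vec Carrier d
      τ v = reduce (a' *ₚ Vec.toList v)

      reduce-inverse : ∀ (b b' : Poly) → (b' *ₚ b) ~ oneₚ → ∀ v → reduce (b' *ₚ Vec.toList (reduce (b *ₚ Vec.toList v))) ≡ v
      reduce-inverse b b' e v = residue-unique _ v (~trans (reduce-~ _) (~trans (~* (~refl {b'}) (reduce-~ _))
                         (~trans (≈⇒~ (≋sym (*ₚ-assoc b' b (Vec.toList v)))) (~trans (~* e (~refl {Vec.toList v})) (≈⇒~ (*ₚ-idˡ _))))))

      τσ : ∀ v → τ (σ v) ≡ v
      τσ = reduce-inverse a a' (~trans (≈⇒~ (*ₚ-comm a' a)) aa')
      στ : ∀ v → σ (τ v) ≡ v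
      στ = reduce-inverse a' a aa'

      σz : σ zeros ≡ zeros
      σz = residue-unique _ zeros (~trans (reduce-~ _) (≈⇒~ (≋trans (*ₚ-congʳ a (zeros-≋[] d)) (≋trans (*ₚ-zeroʳ a) (≋sym (zeros-≋[] d))))))

      pow-card : (∀ x → ¬ x ≡ zeros → KQ.Inv (Vec.toList x)) → (a KQ.^ length (allVecs d)) ~ a
      pow-card units = KQ.fermat-by-reindexing _≟v_ (allVecs d) (allVecs-unique d) (allVecs-complete d) zeros Vec.toList σ τ τσ στ σz a (λ x _ → reduce-~ _) units

    ^-mod≡^ : ∀ x k → (x KQ.^ k) ≡ (x KA.^ k)
    ^-mod≡^ x zero = refl
    ^-mod≡^ x (suc k) = cong (x *ₚ_) (^-mod≡^ x k)

    module Units (monics-invertible : ∀ i → i < d → (b : Vec Carrier i) → KQ.Inv (monic b)) where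
      nonzero-invertible : ∀ n → n ≤ d → (x : Vec Carrier n) → ¬ (Vec.toList x ≋ []) → KQ.Inv (Vec.toList x)
      nonzero-invertible zero le []v nz = ⊥-elim (nz ≋refl)
      nonzero-invertible (suc n) le x nz with lastElem x ≟ 0#
      ... | yes e = KQ.Inv-cong {Vec.toList (initElems x)} {Vec.toList x} (≈⇒~ (≋sym eq)) (nonzero-invertible n (NP.≤-trans (NP.n≤1+n n) le) (initElems x) (λ e' → nz (≋trans eq e')))
        where
        eq : Vec.toList x ≋ Vec.toList (initElems x)
        eq = ≋trans (KA.reflexive (init-++-last x)) (≋trans (KA.reflexive (cong (λ c → Vec.toList (initElems x) ++ [ c ]) e)) (++[0#]≋ _))
      ... | no ne = KQ.Inv-cong {ι c *ₚ monic (Vec.map (inv c ne *_) (initElems x))} {Vec.toList x} (≈⇒~ (≋sym eq)) (KQ.Inv-* {ι c} {monic (Vec.map (inv c ne *_) (initElems x))} ιinv (monics-invertible n le (Vec.map (inv c ne *_) (initElems x))))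
        where
        c = lastElem x
        eq : Vec.toList x ≋ (ι c *ₚ monic (Vec.map (inv c ne *_) (initElems x)))
        eq = ≋trans (KA.reflexive (init-++-last x)) (≋trans (++-scale-last (initElems x) c ne) (scale-ι c (monic (Vec.map (inv c ne *_) (initElems x)))))
        ιinv : KQ.Inv (ι c)
        ιinv = ι (inv c ne) , ≈⇒~ (≋trans (ι-* c (inv c ne)) (ι-cong (inv-r c ne)))

      nonzero-invertible′ : ∀ x → ¬ x ≡ zeros → KQ.Inv (Vec.toList x)
      nonzero-invertible′ x ne = nonzero-invertible d NP.≤-refl x (λ e → ne (toList-injective x zeros (≋trans e (≋sym (zeros-≋[] d)))))

      fermat-mod : ∀ i → i < d → (b : Vec Carrier i) → (monic b KA.^ (q ℕ.^ d ∸ 1)) ~ oneₚ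
      fermat-mod i lt b = KQ.cancelˡ {a} {monic b KA.^ (q ℕ.^ d ∸ 1)} {oneₚ} invA (~trans (≈⇒~ (KA.reflexive a*a^[q^d∸1]≡a^card)) (~trans a^card~a (≈⇒~ (≋sym (*ₚ-idʳ a)))))
        where
        a = monic b
        invA = monics-invertible i lt b
        a' = proj₁ invA
        qd≥1 : 1 ≤ q ℕ.^ d
        qd≥1 = P.subst (λ z → 1 ≤ z ℕ.^ d) (P.sym q≡Q) (Base.1≤Q^k bq d)
        a*a^[q^d∸1]≡a^card : (a *ₚ (a KA.^ (q ℕ.^ d ∸ 1))) ≡ (a KQ.^ length (allVecs d))
        a*a^[q^d∸1]≡a^card = P.trans (cong (a *ₚ_) (P.sym (^-mod≡^ a (q ℕ.^ d ∸ 1)))) (cong (a KQ.^_) (P.trans (P.trans (NP.+-comm 1 (q ℕ.^ d ∸ 1)) (NP.m∸n+n≡m qd≥1)) (P.sym (allVecs-length d))))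
        a^card~a : (a KQ.^ length (allVecs d)) ~ a
        a^card~a = MultiplicationBy.pow-card a a' (proj₂ invA) nonzero-invertible′


module Theorem where

  open import Data.Nat as ℕ using (ℕ; zero; suc; _≤_; _<_; z≤n; s≤s; _∸_; _^_)
  import Data.Nat.Properties as NP
  open import Data.Fin using (Fin)
  open import Data.List using (List; _∷_; map; concatMap; upTo)
  open import Data.Vec using (Vec)
  open import Data.List.Relation.Unary.Any as Any using (here; there)
  open import Data.List.Relation.Unary.All as All using (All)
  open import Data.List.Membership.Propositional using (_∈_)
  open import Data.List.Membership.Propositional.Properties using (∈-map⁺; ∈-map⁻; ∈-++⁺ˡ; ∈-++⁺ʳ; ∈-upTo⁺)
  open import Data.Product using (∃; _×_; _,_)
  open import Data.Sum using (inj₁; inj₂)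
  open import Data.Empty using (⊥-elim)
  open import Relation.Nullary using (¬_; yes; no)
  open import Relation.Binary.PropositionalEquality as P using (_≡_; refl; cong)
  open import Defs
  open Vanishing
  open VectorSums
  open BGRecurrence
  open Residues
  open DigitSums
  import Algebra.Solver.Ring.NaturalCoefficients.Default

  module Setting (F : FiniteField) (n s : ℕ) (n≥1 : 1 ≤ n) (s<ℓ : s < ℓ (Over.q F) n) where
    open VectorSumsOver F
    open R using (Carrier; _*_; 0#; 1#) renaming (_≈_ to _≈F_)
    open KF using () renaming (_^_ to _^F_)
    module SA = Algebra.Solver.Ring.NaturalCoefficients.Default KA.commutativeSemiring

    smallMonics : List Poly
    smallMonics = concatMap monics (upTo (suc n))

    ∈-concatMap : ∀ {i a} (is : List ℕ) → i ∈ is → a ∈ monics i → a ∈ concatMap monics is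
    ∈-concatMap (j ∷ is) (here refl) m = ∈-++⁺ˡ m
    ∈-concatMap (j ∷ is) (there mi) m = ∈-++⁺ʳ (monics j) (∈-concatMap is mi m)

    degree>n : ∀ d (cs : Vec Carrier d) → NotIn (monic cs) smallMonics → n < d
    degree>n d cs ni with n ℕ.<? d
    ... | yes lt = lt
    ... | no nlt = ⊥-elim (ni (Any.map (λ { refl → λ i → refl })
                    (∈-concatMap (upTo (suc n)) (∈-upTo⁺ (s≤s (NP.≮⇒≥ nlt))) (∈-map⁺ monic (allVecs-complete d cs)))))

    n<q^d : ∀ d → n < d → n < q ^ d
    n<q^d d nd = P.subst (λ z → n < z ^ d) (P.sym q≡Q) (NP.<-trans nd (Base.k<Q^k bq d))

    -- By ℓ(q^d - 1 - n) + ℓ(n) = d(q - 1) and ℓ(n) > s.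
    digitSum-bound : ∀ d → n < d → s ℕ.+ digitSumAux bq (q ^ d ∸ 1 ∸ n) (q ^ d ∸ 1 ∸ n) < d ℕ.* (q ∸ 1)
    digitSum-bound d nd = P.subst (λ z → s ℕ.+ Base.digitSum bq (z ^ d ∸ 1 ∸ n) < d ℕ.* (z ∸ 1)) (P.sym q≡Q)
        (P.subst (s ℕ.+ Base.digitSum bq (Q ^ d ∸ 1 ∸ n) <_)
          (P.trans (NP.+-comm (Base.digitSum bq n) _) (Base.digitSum-complement bq d n (NP.<-trans nd (Base.k<Q^k bq d))))
          (NP.+-monoˡ-< (Base.digitSum bq (Q ^ d ∸ 1 ∸ n)) (P.subst (λ z → s < ℓ z n) q≡Q s<ℓ)))

    module AtModulus (d' : ℕ) (cs : Vec Carrier (suc d')) (nd : n < suc d')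
                     (invP : Poly → Poly) (invP-spec : InvFamily n (suc d') (monic cs) invP) where
      open ModuloMonic F d' cs using (d; module KQ; module Units; CongMod⇒~; ~⇒CongMod; scale-~; sumₚ-map-mod)
      open ModuloMonic.Mod F d' cs using (_~_; ≈⇒~; ~refl; ~sym; ~trans; ~+; ~*)

      N : ℕ
      N = q ^ d ∸ 1 ∸ n

      N+n≡q^d∸1 : N ℕ.+ n ≡ q ^ d ∸ 1
      N+n≡q^d∸1 = NP.m∸n+n≡m (NP.≤-pred (P.subst (suc n ≤_) (P.sym (NP.suc-pred (q ^ d) ⦃ ℕ.>-nonZero (NP.≤-<-trans z≤n (n<q^d d nd)) ⦄)) (n<q^d d nd)))

      monics-invertible : ∀ i → i < d → (b : Vec Carrier i) → KQ.Inv (monic b)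
      monics-invertible i lt b = (invP a *ₚ (a ^ₚ (n ∸ 1))) ,
          ~trans (≈⇒~ (SA.solve 3 (λ a x p → a SA.:* (x SA.:* p) SA.:= x SA.:* (a SA.:* p)) ≋refl a (invP a) (a ^ₚ (n ∸ 1))))
            (~trans (≈⇒~ (KA.reflexive (cong (λ k → invP a *ₚ (a ^ₚ k)) (NP.suc-pred n ⦃ ℕ.>-nonZero n≥1 ⦄))))
              (CongMod⇒~ (All.lookup (invP-spec i lt) (∈-map⁺ monic (allVecs-complete i b)))))
        where
        a = monic b

      inverse~pow : ∀ i → i < d → ∀ a → a ∈ monics i → invP a ~ (a ^ₚ N)
      inverse~pow i lt a m with ∈-map⁻ monic m
      ... | b , _ , refl = ~trans (≈⇒~ (≋sym (*ₚ-idʳ (invP a))))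
                           (~trans (~* (~refl {invP a}) (~sym (Units.fermat-mod monics-invertible i lt b)))
                           (~trans (≈⇒~ (KA.reflexive (cong (λ z → invP a *ₚ (a KA.^ z)) (P.sym N+n≡q^d∸1))))
                           (~trans (≈⇒~ (*ₚ-congʳ (invP a) (KA.^-homo-* a N n)))
                           (~trans (≈⇒~ (SA.solve 3 (λ x p r → x SA.:* (p SA.:* r) SA.:= p SA.:* (x SA.:* r)) ≋refl (invP a) (a KA.^ N) (a KA.^ n)))
                           (~trans (~* (~refl {a KA.^ N}) (~trans (≈⇒~ (KA.reflexive (cong (invP a *ₚ_) (P.sym (^ₚ≡ a n))))) (CongMod⇒~ (All.lookup (invP-spec i lt) m))))
                           (≈⇒~ (≋trans (*ₚ-idʳ _) (KA.reflexive (P.sym (^ₚ≡ a N))))))))))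

      Zcoeff~ΣBGterm : ∀ m → Zcoeff d s invP m ~ sumBelow d (λ j → BGterm N s j m)
      Zcoeff~ΣBGterm m = go d NP.≤-refl
        where
        go : ∀ J → J ≤ d → sumBelow J (λ i → sumₚ (map (λ a → scale (tCoeff s m a) (invP a)) (monics i))) ~ sumBelow J (λ j → BGterm N s j m)
        go zero _ = ~refl
        go (suc J) le = ~+ (go J (NP.≤-trans (NP.n≤1+n J) le))
                           (~trans (≈⇒~ (KA.reflexive (sumₚ-map-mod _ (monics J))))
                           (~trans (KQ.Σl-cong∈ (monics J) (λ a mem → scale-~ (tCoeff s m a) (inverse~pow J le a mem)))
                           (≈⇒~ (KA.reflexive (P.sym (sumₚ-map-mod _ (monics J)))))))

      BGterm-vanishes : ∀ j → d ≤ j → ∀ (m : Fin s → ℕ) → BGterm N s j m ≈ₚ zeroₚ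
      BGterm-vanishes j le m = at (≋trans (KA.reflexive (RecurrenceOver.BGterm-as-ΣVec F N s m j))
                                          (VanishingOver.Σ-summand≋[] F oneₚ j N s m (NP.<-≤-trans (digitSum-bound d nd) (NP.*-monoˡ-≤ (q ∸ 1) le))))

      x^[s+N]≈1 : CongNat (q ∸ 1) s n → ∀ c → ¬ c ≡ 0# → c ^F (s ℕ.+ N) ≈F 1#
      x^[s+N]≈1 (k , inj₁ s≡n+k[q∸1]) c nz =
        R.trans (R.reflexive (cong (c ^F_) s+N≡))
          (R.trans (KF.^-homo-* c (q ^ d ∸ 1) (k ℕ.* (q ∸ 1))) (R.trans (R.*-cong (x^[q^k∸1]≈1 c nz d) (x^[k*[q∸1]]≈1 c nz k)) (R.*-identityˡ 1#)))
        where
        s+N≡ : s ℕ.+ N ≡ (q ^ d ∸ 1) ℕ.+ k ℕ.* (q ∸ 1)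
        s+N≡ = P.trans (cong (ℕ._+ N) s≡n+k[q∸1]) (P.trans (NP.+-comm (n ℕ.+ k ℕ.* (q ∸ 1)) N)
                 (P.trans (P.sym (NP.+-assoc N n _)) (cong (ℕ._+ k ℕ.* (q ∸ 1)) N+n≡q^d∸1)))
      x^[s+N]≈1 (k , inj₂ n≡s+k[q∸1]) c nz =
        R.trans (R.sym (R.*-identityʳ _)) (R.trans (R.*-cong R.refl (R.sym (x^[k*[q∸1]]≈1 c nz k)))
          (R.trans (R.sym (KF.^-homo-* c (s ℕ.+ N) (k ℕ.* (q ∸ 1)))) (R.trans (R.reflexive (cong (c ^F_) s+N+k[q∸1]≡)) (x^[q^k∸1]≈1 c nz d))))
        where
        s+N+k[q∸1]≡ : (s ℕ.+ N) ℕ.+ k ℕ.* (q ∸ 1) ≡ q ^ d ∸ 1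
        s+N+k[q∸1]≡ = P.trans (cong (ℕ._+ k ℕ.* (q ∸ 1)) (NP.+-comm s N))
                        (P.trans (NP.+-assoc N s _) (P.trans (cong (N ℕ.+_) (P.sym n≡s+k[q∸1])) N+n≡q^d∸1))

      N≡1+[N∸1] : N ≡ suc (N ∸ 1)
      N≡1+[N∸1] = P.sym (NP.suc-pred N ⦃ ℕ.>-nonZero (NP.m<n⇒0<n∸m n<q^d∸1) ⦄)
        where
        n<q^d∸1 : n < q ^ d ∸ 1
        n<q^d∸1 = NP.<-≤-trans (NP.n<1+n n) (NP.≤-trans (s≤s (NP.≤-refl {n}))
                    (NP.≤-pred (P.subst (λ z → suc (suc n) ≤ z) (P.sym (NP.suc-pred (q ^ d) ⦃ ℕ.>-nonZero (NP.≤-<-trans z≤n (n<q^d d nd)) ⦄))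
                      (P.subst (λ z → suc (suc n) ≤ z ^ d) (P.sym q≡Q) (NP.≤-trans (s≤s nd) (Base.k<Q^k bq d))))))

    BG-congruence : ∀ d (cs : Vec Carrier d) → Irreducible (monic cs) → NotIn (monic cs) smallMonics →
      ∀ (invP : Poly → Poly) → InvFamily n d (monic cs) invP →
      ∃ λ (J : ℕ) → (∀ j → J ≤ j → ∀ (m : Fin s → ℕ) → BGterm (q ^ d ∸ 1 ∸ n) s j m ≈ₚ zeroₚ)
        × (∀ (m : Fin s → ℕ) → CongMod (monic cs) (Zcoeff d s invP m) (sumBelow J (λ j → BGterm (q ^ d ∸ 1 ∸ n) s j m)))
    BG-congruence zero cs _ ni = ⊥-elim (NP.n≮0 (degree>n zero cs ni))
    BG-congruence (suc d') cs _ ni invP invP-spec =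
      suc d' , BGterm-vanishes , λ m → ModuloMonic.~⇒CongMod F d' cs (Zcoeff~ΣBGterm m)
      where open AtModulus d' cs (degree>n (suc d') cs ni) invP invP-spec

    Z-vanishes : CongNat (q ∸ 1) s n → ∀ d (cs : Vec Carrier d) → Irreducible (monic cs) → NotIn (monic cs) smallMonics →
      ∀ (invP : Poly → Poly) → InvFamily n d (monic cs) invP → ∀ (m : Fin s → ℕ) → CongMod (monic cs) (Zcoeff d s invP m) zeroₚ
    Z-vanishes _ zero cs _ ni = ⊥-elim (NP.n≮0 (degree>n zero cs ni))
    Z-vanishes s≡n (suc d') cs _ ni invP invP-spec m =
      ModuloMonic.~⇒CongMod F d' cs (ModuloMonic.Mod.~trans F d' cs (Zcoeff~ΣBGterm m)
        (ModuloMonic.Mod.≈⇒~ F d' cs (RecurrenceOver.Homogeneous.ΣBGterm≋[] F N s m (x^[s+N]≈1 s≡n) (N ∸ 1) N≡1+[N∸1] (suc d') (digitSum-bound (suc d') nd))))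
      where
      nd = degree>n (suc d') cs ni
      open AtModulus d' cs nd invP invP-spec


open import Defs
open import Data.Nat using (ℕ; _≤_; _<_; _∸_; _^_)
open import Data.Fin using (Fin)
open import Data.List using (List)
open import Data.Vec using (Vec)
open import Data.Product using (∃; _×_; _,_)
open import Algebra.Bundles using (CommutativeRing)

theorem7 : (F : FiniteField) → let open FiniteField F in let open Over F in let open CommutativeRing ring using (Carrier) in
  (n s : ℕ) → 1 ≤ n → s < ℓ q n →
    (∃ λ (L : List Poly) → ∀ (d : ℕ) (cs : Vec Carrier d) → Irreducible (monic cs) → NotIn (monic cs) L →
      ∀ (inv : Poly → Poly) → InvFamily n d (monic cs) inv →
        ∃ λ (J : ℕ) → (∀ j → J ≤ j → ∀ (m : Fin s → ℕ) → BGterm (q ^ d ∸ 1 ∸ n) s j m ≈ₚ zeroₚ)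
          × (∀ (m : Fin s → ℕ) → CongMod (monic cs) (Zcoeff d s inv m) (sumBelow J (λ j → BGterm (q ^ d ∸ 1 ∸ n) s j m))))
    × (CongNat (q ∸ 1) s n →
      ∃ λ (L : List Poly) → ∀ (d : ℕ) (cs : Vec Carrier d) → Irreducible (monic cs) → NotIn (monic cs) L →
        ∀ (inv : Poly → Poly) → InvFamily n d (monic cs) inv →
          ∀ (m : Fin s → ℕ) → CongMod (monic cs) (Zcoeff d s inv m) zeroₚ)
theorem7 F n s n≥1 s<ℓ = (smallMonics , BG-congruence) , λ s≡n → smallMonics , Z-vanishes s≡n
  where open Theorem.Setting F n s n≥1 s<ℓ
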